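{- For every $\varepsilon>0$ there exist positive integers $d_\varepsilon,N_\varepsilon$ such that for all integers $d\ge d_\varepsilon$, $N\ge N_\varepsilon$, and every point $\mathbf a\in\mathcal W(d,N)$, the proportion of triangles $(\mathbf a,\mathbf w_1,\mathbf w_2)$ with $\mathbf w_1,\mathbf w_2\in\mathcal W(d,N)$ for which $$\Bigl|\operatorname{dist}_d(\mathbf w_1,\mathbf w_2)-\tfrac{1}{\sqrt6}\Bigr|\le\varepsilon\quad\text{and}\quad\Bigl|\operatorname{dist}_d(\mathbf a,\mathbf w_j)-\sqrt{\tfrac1{12}+r_{\mathbf a}^2}\Bigr|\le\varepsilon\ \text{ for } j=1,2$$ is at least $1-\varepsilon$, where $r_{\mathbf a}=\operatorname{dist}_d(\mathbf a,\mathbf c)$.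
   Context: For integers $d,N\ge1$, $\mathcal W(d,N)=\{0,1,\dots,N\}^d$ is the set of lattice points of $[0,N]^d$ and $\mathbf c=(N/2,\dots,N/2)$ its center. The normalized distance is $\operatorname{dist}_d(\mathbf u,\mathbf v)=\frac{1}{\sqrt d\,N}\bigl(\sum_{j=1}^d(u_j-v_j)^2\bigr)^{1/2}$. Triangles are counted as pairs $(\mathbf w_1,\mathbf w_2)\in\mathcal W^2$ forming with $\mathbf a$ a triangle.
   Formalization: The tolerance ε ranges over the positive rationals. -}

module Defs where

open import Data.Bool using (Bool; _∨_; _∧_)
open import Data.Nat as ℕ using (ℕ; zero; suc; _∸_)
open import Data.Integer as ℤ using (ℤ; +_)
open import Data.Rational using (ℚ; _/_; _+_; _-_; _*_; _≤ᵇ_; 0ℚ; 1ℚ)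
open import Data.List using (List; []; _∷_; map; concatMap; upTo; length; filterᵇ; cartesianProduct)
open import Data.Vec using (Vec; []; _∷_)
open import Data.Product using (_×_; _,_)

-- frac n m = n / m as a rational (only used with m > 0; value 0 when m = 0)
frac : ℕ → ℕ → ℚ
frac n zero    = 0ℚ
frac n (suc m) = (+ n) / suc m

absDiff : ℕ → ℕ → ℕ
absDiff x y = (x ∸ y) ℕ.+ (y ∸ x)

sqDist : ∀ {d} → Vec ℕ d → Vec ℕ d → ℕ
sqDist []       []       = 0
sqDist (u ∷ us) (v ∷ vs) = absDiff u v ℕ.* absDiff u v ℕ.+ sqDist us vs

distSq : (d N : ℕ) → Vec ℕ d → Vec ℕ d → ℚ
distSq d N u v = frac (sqDist u v) (d ℕ.* N ℕ.* N)

sqDev : ∀ {d} → ℕ → Vec ℕ d → ℕ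
sqDev N []       = 0
sqDev N (a ∷ as) = absDiff (2 ℕ.* a) N ℕ.* absDiff (2 ℕ.* a) N ℕ.+ sqDev N as

-- r_a^2 = dist_d(a, c)^2 with c = (N/2,...,N/2):  Σ_j (a_j - N/2)^2 / (d N^2)
rSq : (d N : ℕ) → Vec ℕ d → ℚ
rSq d N a = frac (sqDev N a) (4 ℕ.* d ℕ.* N ℕ.* N)

-- For rationals x, y ≥ 0 and ε ≥ 0:  sqrtLe x y ε  decides  √x ≤ √y + ε,
-- i.e. x ≤ y + ε² + 2ε√y, i.e. with t = x - y - ε²:  t ≤ 0  or  t² ≤ 4ε²y.
sqrtLe : ℚ → ℚ → ℚ → Bool
sqrtLe x y ε = (t ≤ᵇ 0ℚ) ∨ ((t * t) ≤ᵇ ((+ 4 / 1) * ε * ε * y))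
  where t = x - y - ε * ε

sqrtClose : ℚ → ℚ → ℚ → Bool
sqrtClose x y ε = sqrtLe x y ε ∧ sqrtLe y x ε

grid : (d N : ℕ) → List (Vec ℕ d)
grid zero    N = [] ∷ []
grid (suc d) N = concatMap (λ x → map (x ∷_) (grid d N)) (upTo (suc N))

sixth twelfth : ℚ
sixth   = + 1 / 6
twelfth = + 1 / 12

good : (d N : ℕ) → ℚ → Vec ℕ d → Vec ℕ d × Vec ℕ d → Bool
good d N ε a (w₁ , w₂) =
  sqrtClose (distSq d N w₁ w₂) sixth ε
  ∧ sqrtClose (distSq d N a w₁) (twelfth + rSq d N a) ε
  ∧ sqrtClose (distSq d N a w₂) (twelfth + rSq d N a) ε

pairs : (d N : ℕ) → List (Vec ℕ d × Vec ℕ d)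
pairs d N = cartesianProduct (grid d N) (grid d N)

goodCount : (d N : ℕ) → ℚ → Vec ℕ d → ℕ
goodCount d N ε a = length (filterᵇ (good d N ε a) (pairs d N))

totalCount : (d N : ℕ) → ℕ
totalCount d N = length (pairs d N)

toℚ : ℕ → ℚ
toℚ n = frac n 1

module Submission where

-- Fix k ≥ 1 with 1/k ≤ ε. For (w₁ , w₂) uniform in W², each of the squared distances
-- |w₁ − w₂|², |a − w₁|², |a − w₂|² is a sum of d independent coordinate terms with values
-- in [0, N²], so once centred its variance is at most d N⁴, and its mean is explicit:
-- d (N² + 2N) / 6, resp. |a − c|² + d (N² + 2N) / 12. By Chebyshev's inequality all three
-- lie within d N² / (2k²) of their means except on a fraction 12k⁴/d ≤ 1/k of the pairs
-- when d ≥ 12k⁵. When N ≥ 2k² the normalised means are within 1/(6k²) of 1/6 and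
-- 1/12 + r_a², so the normalised squared distances are within 1/k² ≤ ε² of these, and
-- |√x − √y| ≤ √|x − y| concludes.

open import Defs
open import Data.Nat using (ℕ)

module FiniteSums where

  open import Data.Bool using (Bool; true; false; T)
  open import Data.Integer as ℤ using (ℤ; +_; 0ℤ; _+_; _*_; _≤_)
  import Data.Integer.Properties as ℤ
  open import Data.Integer.Tactic.RingSolver using (solve-∀)
  open import Data.List using (List; []; _∷_; _++_; map; concatMap; cartesianProduct; length; filterᵇ)
  open import Data.List.Membership.Propositional using (_∈_)
  open import Data.List.Relation.Unary.Any using (here; there)
  open import Data.Product using (_×_; _,_)
  open import Data.Sum using (_⊎_; inj₁; inj₂)
  open import Function using (_∘_)
  open import Relation.Binary.PropositionalEquality using (_≡_; refl; sym; trans; cong; cong₂; module ≡-Reasoning)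

  private variable
    A B : Set

  ∑ : (A → ℤ) → List A → ℤ
  ∑ f []       = 0ℤ
  ∑ f (x ∷ xs) = f x + ∑ f xs

  syntax ∑ (λ x → e) xs = ∑[ x ∈ xs ] e

  ∑-++ : ∀ (f : A → ℤ) xs ys → ∑ f (xs ++ ys) ≡ ∑ f xs + ∑ f ys
  ∑-++ f []       ys = sym (ℤ.+-identityˡ _)
  ∑-++ f (x ∷ xs) ys = trans (cong (_+_ (f x)) (∑-++ f xs ys)) (sym (ℤ.+-assoc (f x) _ _))

  ∑-map : ∀ (f : B → ℤ) (g : A → B) xs → ∑ f (map g xs) ≡ ∑ (f ∘ g) xs
  ∑-map f g []       = refl
  ∑-map f g (x ∷ xs) = cong (_+_ (f (g x))) (∑-map f g xs)

  ∑-concatMap : ∀ (f : B → ℤ) (g : A → List B) xs → ∑ f (concatMap g xs) ≡ ∑[ x ∈ xs ] ∑ f (g x)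
  ∑-concatMap f g []       = refl
  ∑-concatMap f g (x ∷ xs) = trans (∑-++ f (g x) _) (cong (_+_ (∑ f (g x))) (∑-concatMap f g xs))

  ∑-cartesianProduct : ∀ (f : A × B → ℤ) xs ys →
    ∑ f (cartesianProduct xs ys) ≡ ∑[ x ∈ xs ] ∑[ y ∈ ys ] f (x , y)
  ∑-cartesianProduct f []       ys = refl
  ∑-cartesianProduct f (x ∷ xs) ys =
    trans (∑-++ f (map (x ,_) ys) _) (cong₂ _+_ (∑-map f (x ,_) ys) (∑-cartesianProduct f xs ys))

  ∑-cong : ∀ {f g : A → ℤ} → (∀ x → f x ≡ g x) → ∀ xs → ∑ f xs ≡ ∑ g xs
  ∑-cong f≗g []       = refl
  ∑-cong f≗g (x ∷ xs) = cong₂ _+_ (f≗g x) (∑-cong f≗g xs)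

  ∑-+ : ∀ (f g : A → ℤ) xs → ∑[ x ∈ xs ] (f x + g x) ≡ ∑ f xs + ∑ g xs
  ∑-+ f g []       = refl
  ∑-+ f g (x ∷ xs) = trans (cong (_+_ (f x + g x)) (∑-+ f g xs)) (interchange (f x) (g x) _ _)
    where
    interchange : ∀ a b c d → a + b + (c + d) ≡ a + c + (b + d)
    interchange = solve-∀

  ∑-*ˡ : ∀ c (f : A → ℤ) xs → ∑[ x ∈ xs ] (c * f x) ≡ c * ∑ f xs
  ∑-*ˡ c f []       = sym (ℤ.*-zeroʳ c)
  ∑-*ˡ c f (x ∷ xs) = trans (cong (_+_ (c * f x)) (∑-*ˡ c f xs)) (sym (ℤ.*-distribˡ-+ c (f x) _))

  ∑-const : ∀ c (xs : List A) → ∑[ x ∈ xs ] c ≡ + length xs * c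
  ∑-const c []       = sym (ℤ.*-zeroˡ c)
  ∑-const c (x ∷ xs) = trans (cong (_+_ c) (∑-const c xs)) (sym (ℤ.suc-* (+ length xs) c))

  ∑-swap : ∀ (f : A → B → ℤ) xs ys → ∑[ x ∈ xs ] ∑[ y ∈ ys ] f x y ≡ ∑[ y ∈ ys ] ∑[ x ∈ xs ] f x y
  ∑-swap f []       ys = sym (trans (∑-const 0ℤ ys) (ℤ.*-zeroʳ (+ length ys)))
  ∑-swap f (x ∷ xs) ys = trans (cong (_+_ (∑ (f x) ys)) (∑-swap f xs ys)) (sym (∑-+ (f x) _ ys))

  ∑-mono-≤ : ∀ {f g : A → ℤ} xs → (∀ {x} → x ∈ xs → f x ≤ g x) → ∑ f xs ≤ ∑ g xs
  ∑-mono-≤ []       f≤g = ℤ.≤-refl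
  ∑-mono-≤ (x ∷ xs) f≤g = ℤ.+-mono-≤ (f≤g (here refl)) (∑-mono-≤ xs (f≤g ∘ there))

  ∑-linear : ∀ a c (f : A → ℤ) xs → ∑[ x ∈ xs ] (a * f x + c) ≡ a * ∑ f xs + + length xs * c
  ∑-linear a c f xs = trans (∑-+ (λ x → a * f x) (λ _ → c) xs) (cong₂ _+_ (∑-*ˡ a f xs) (∑-const c xs))

  ∑-affine : ∀ a b c (f g : A → ℤ) xs →
    ∑[ x ∈ xs ] (a * f x + b * g x + c) ≡ a * ∑ f xs + b * ∑ g xs + + length xs * c
  ∑-affine a b c f g xs = begin
    ∑[ x ∈ xs ] (a * f x + b * g x + c)
      ≡⟨ ∑-+ (λ x → a * f x + b * g x) (λ _ → c) xs ⟩
    ∑[ x ∈ xs ] (a * f x + b * g x) + ∑[ x ∈ xs ] c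
      ≡⟨ cong₂ _+_ (∑-+ (λ x → a * f x) (λ x → b * g x) xs) (∑-const c xs) ⟩
    ∑[ x ∈ xs ] (a * f x) + ∑[ x ∈ xs ] (b * g x) + + length xs * c
      ≡⟨ cong (λ s → s + + length xs * c) (cong₂ _+_ (∑-*ˡ a f xs) (∑-*ˡ b g xs)) ⟩
    a * ∑ f xs + b * ∑ g xs + + length xs * c ∎
    where open ≡-Reasoning

  ∑-∑-square : ∀ (f : A → ℤ) (g : B → ℤ) xs ys → ∑ f xs ≡ 0ℤ →
    ∑[ x ∈ xs ] ∑[ y ∈ ys ] ((f x + g y) * (f x + g y))
      ≡ + length ys * ∑[ x ∈ xs ] (f x * f x) + + length xs * ∑[ y ∈ ys ] (g y * g y)
  ∑-∑-square f g xs ys ∑f≡0 = begin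
    ∑[ x ∈ xs ] ∑[ y ∈ ys ] ((f x + g y) * (f x + g y))
      ≡⟨ ∑-cong inner xs ⟩
    ∑[ x ∈ xs ] (+ 2 * G * f x + m * (f x * f x) + Q)
      ≡⟨ ∑-affine (+ 2 * G) m Q f (λ x → f x * f x) xs ⟩
    + 2 * G * ∑ f xs + m * ∑[ x ∈ xs ] (f x * f x) + + length xs * Q
      ≡⟨ cong (λ s → + 2 * G * s + m * ∑[ x ∈ xs ] (f x * f x) + + length xs * Q) ∑f≡0 ⟩
    + 2 * G * 0ℤ + m * ∑[ x ∈ xs ] (f x * f x) + + length xs * Q
      ≡⟨ drop-zero (+ 2 * G) (m * ∑[ x ∈ xs ] (f x * f x)) (+ length xs * Q) ⟩
    m * ∑[ x ∈ xs ] (f x * f x) + + length xs * Q ∎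
    where
    open ≡-Reasoning
    m = + length ys
    G = ∑ g ys
    Q = ∑[ y ∈ ys ] (g y * g y)
    expand : ∀ a b → (a + b) * (a + b) ≡ + 2 * a * b + + 1 * (b * b) + a * a
    expand = solve-∀
    regroup : ∀ a G m Q → + 2 * a * G + + 1 * Q + m * (a * a) ≡ + 2 * G * a + m * (a * a) + Q
    regroup = solve-∀
    drop-zero : ∀ a b c → a * 0ℤ + b + c ≡ b + c
    drop-zero = solve-∀
    inner : ∀ x → ∑[ y ∈ ys ] ((f x + g y) * (f x + g y)) ≡ + 2 * G * f x + m * (f x * f x) + Q
    inner x = begin
      ∑[ y ∈ ys ] ((f x + g y) * (f x + g y))
        ≡⟨ ∑-cong (λ y → expand (f x) (g y)) ys ⟩
      ∑[ y ∈ ys ] (+ 2 * f x * g y + + 1 * (g y * g y) + f x * f x)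
        ≡⟨ ∑-affine (+ 2 * f x) (+ 1) (f x * f x) g (λ y → g y * g y) ys ⟩
      + 2 * f x * G + + 1 * Q + m * (f x * f x)
        ≡⟨ regroup (f x) G m Q ⟩
      + 2 * G * f x + m * (f x * f x) + Q ∎

  markov : ∀ (good : A → Bool) (f : A → ℤ) t → (∀ x → 0ℤ ≤ f x) → (∀ x → T (good x) ⊎ t ≤ f x) →
    ∀ xs → + length xs * t ≤ + length (filterᵇ good xs) * t + ∑ f xs
  markov good f t f≥0 good⊎large []       = ℤ.≤-refl
  markov good f t f≥0 good⊎large (x ∷ xs) with good x | good⊎large x
  ... | true  | _ = begin
    + length (x ∷ xs) * t                  ≡⟨ ℤ.suc-* (+ length xs) t ⟩
    t + + n * t                            ≤⟨ ℤ.+-monoʳ-≤ t ih ⟩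
    t + (+ g * t + ∑ f xs)                 ≤⟨ ℤ.+-monoʳ-≤ t (ℤ.+-monoʳ-≤ (+ g * t) ∑≤fx+∑) ⟩
    t + (+ g * t + (f x + ∑ f xs))         ≡⟨ ℤ.+-assoc t _ _ ⟨
    t + + g * t + (f x + ∑ f xs)           ≡⟨ cong (_+ (f x + ∑ f xs)) (ℤ.suc-* (+ g) t) ⟨
    + length (x ∷ filterᵇ good xs) * t + ∑ f (x ∷ xs) ∎
    where
    open ℤ.≤-Reasoning
    n = length xs
    g = length (filterᵇ good xs)
    ih = markov good f t f≥0 good⊎large xs
    ∑≤fx+∑ = ℤ.i≤j+i (∑ f xs) (f x) {{ℤ.nonNegative (f≥0 x)}}
  ... | false | inj₁ ()
  ... | false | inj₂ t≤fx = begin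
    + length (x ∷ xs) * t                  ≡⟨ ℤ.suc-* (+ length xs) t ⟩
    t + + n * t                            ≤⟨ ℤ.+-mono-≤ t≤fx ih ⟩
    f x + (+ g * t + ∑ f xs)               ≡⟨ swap (f x) (+ g * t) (∑ f xs) ⟩
    + g * t + (f x + ∑ f xs) ∎
    where
    open ℤ.≤-Reasoning
    n = length xs
    g = length (filterᵇ good xs)
    ih = markov good f t f≥0 good⊎large xs
    swap : ∀ a b c → a + (b + c) ≡ b + (a + c)
    swap = solve-∀

  count-from-markov : ∀ k T G τ B .{{_ : ℤ.Positive τ}} →
    + T * τ ≤ + G * τ + B → + k * B ≤ + T * τ → + k * + T ≤ + k * + G + + T
  count-from-markov k T G τ B markov-bound budget = ℤ.*-cancelʳ-≤-pos _ _ τ (begin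
    + k * + T * τ                 ≡⟨ ℤ.*-assoc (+ k) (+ T) τ ⟩
    + k * (+ T * τ)               ≤⟨ ℤ.*-monoˡ-≤-nonNeg (+ k) markov-bound ⟩
    + k * (+ G * τ + B)           ≡⟨ ℤ.*-distribˡ-+ (+ k) (+ G * τ) B ⟩
    + k * (+ G * τ) + + k * B     ≤⟨ ℤ.+-monoʳ-≤ (+ k * (+ G * τ)) budget ⟩
    + k * (+ G * τ) + + T * τ     ≡⟨ regroup (+ k) (+ G) (+ T) τ ⟩
    (+ k * + G + + T) * τ         ∎)
    where
    open ℤ.≤-Reasoning
    regroup : ∀ k G T τ → k * (G * τ) + T * τ ≡ (k * G + T) * τ
    regroup = solve-∀

module Lattice where

  open import Data.Nat as ℕ using (ℕ; suc)
  import Data.Nat.Properties as ℕ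
  open import Data.Integer as ℤ using (ℤ; +_; _*_)
  import Data.Integer.Properties as ℤ
  open import Data.List using (List; []; _∷_; _++_; map; cartesianProduct; length; upTo)
  import Data.List.Properties as List
  open import Data.List.Membership.Propositional using (_∈_)
  open import Data.List.Membership.Propositional.Properties using (∈-cartesianProduct⁻; ∈-upTo⁻)
  open import Data.Vec using (Vec; []; _∷_)
  open import Data.Product using (_×_; _,_)
  open import Relation.Binary.PropositionalEquality using (_≡_; refl; trans; cong₂; module ≡-Reasoning)
  open FiniteSums

  cells : ℕ → List (ℕ × ℕ)
  cells N = cartesianProduct (upTo (suc N)) (upTo (suc N))

  ∈-cells⁻ : ∀ N {u v} → (u , v) ∈ cells N → u ℕ.≤ N × v ℕ.≤ N
  ∈-cells⁻ N uv∈ with u∈ , v∈ ← ∈-cartesianProduct⁻ (upTo (suc N)) (upTo (suc N)) uv∈ =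
    ℕ.≤-pred (∈-upTo⁻ u∈) , ℕ.≤-pred (∈-upTo⁻ v∈)

  length-cartesianProduct : ∀ {A B : Set} (xs : List A) (ys : List B) →
    length (cartesianProduct xs ys) ≡ length xs ℕ.* length ys
  length-cartesianProduct []       ys = refl
  length-cartesianProduct (x ∷ xs) ys = begin
    length (map (x ,_) ys ++ cartesianProduct xs ys)     ≡⟨ List.length-++ (map (x ,_) ys) ⟩
    length (map (x ,_) ys) ℕ.+ length (cartesianProduct xs ys)
      ≡⟨ cong₂ ℕ._+_ (List.length-map (x ,_) ys) (length-cartesianProduct xs ys) ⟩
    length ys ℕ.+ length xs ℕ.* length ys               ∎
    where open ≡-Reasoning

  length-cells : ∀ N → length (cells N) ≡ suc N ℕ.* suc N
  length-cells N = trans (length-cartesianProduct (upTo (suc N)) (upTo (suc N)))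
                         (cong₂ ℕ._*_ (List.length-upTo (suc N)) (List.length-upTo (suc N)))

  infixr 5 _∷²_
  _∷²_ : ∀ {d} → ℕ × ℕ → Vec ℕ d × Vec ℕ d → Vec ℕ (suc d) × Vec ℕ (suc d)
  (u , v) ∷² (w₁ , w₂) = u ∷ w₁ , v ∷ w₂

  ∑-grid-suc : ∀ d N (f : Vec ℕ (suc d) → ℤ) →
    ∑ f (grid (suc d) N) ≡ ∑[ u ∈ upTo (suc N) ] ∑[ w ∈ grid d N ] f (u ∷ w)
  ∑-grid-suc d N f = trans (∑-concatMap f (λ u → map (u ∷_) (grid d N)) (upTo (suc N)))
                           (∑-cong (λ u → ∑-map f (u ∷_) (grid d N)) (upTo (suc N)))

  ∑-pairs-suc : ∀ d N (F : Vec ℕ (suc d) × Vec ℕ (suc d) → ℤ) →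
    ∑ F (pairs (suc d) N) ≡ ∑[ uv ∈ cells N ] ∑[ p ∈ pairs d N ] F (uv ∷² p)
  ∑-pairs-suc d N F = begin
    ∑ F (pairs (suc d) N)
      ≡⟨ ∑-cartesianProduct F (grid (suc d) N) (grid (suc d) N) ⟩
    ∑[ w₁ ∈ grid (suc d) N ] ∑[ w₂ ∈ grid (suc d) N ] F (w₁ , w₂)
      ≡⟨ ∑-grid-suc d N _ ⟩
    ∑[ u ∈ U ] ∑[ w₁ ∈ G ] ∑[ w₂ ∈ grid (suc d) N ] F (u ∷ w₁ , w₂)
      ≡⟨ ∑-cong (λ u → ∑-cong (λ w₁ → ∑-grid-suc d N _) G) U ⟩
    ∑[ u ∈ U ] ∑[ w₁ ∈ G ] ∑[ v ∈ U ] ∑[ w₂ ∈ G ] F (u ∷ w₁ , v ∷ w₂)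
      ≡⟨ ∑-cong (λ u → ∑-swap (λ w₁ v → ∑[ w₂ ∈ G ] F (u ∷ w₁ , v ∷ w₂)) G U) U ⟩
    ∑[ u ∈ U ] ∑[ v ∈ U ] ∑[ w₁ ∈ G ] ∑[ w₂ ∈ G ] F (u ∷ w₁ , v ∷ w₂)
      ≡⟨ ∑-cong (λ u → ∑-cong (λ v → ∑-cartesianProduct (λ p → F ((u , v) ∷² p)) G G) U) U ⟨
    ∑[ u ∈ U ] ∑[ v ∈ U ] ∑[ p ∈ pairs d N ] F ((u , v) ∷² p)
      ≡⟨ ∑-cartesianProduct (λ uv → ∑[ p ∈ pairs d N ] F (uv ∷² p)) U U ⟨
    ∑[ uv ∈ cells N ] ∑[ p ∈ pairs d N ] F (uv ∷² p) ∎
    where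
    open ≡-Reasoning
    U = upTo (suc N)
    G = grid d N

  ∑-1 : ∀ {A : Set} (xs : List A) → ∑[ x ∈ xs ] (+ 1) ≡ + length xs
  ∑-1 xs = trans (∑-const (+ 1) xs) (ℤ.*-identityʳ (+ length xs))

  length-pairs-suc : ∀ d N → + length (pairs (suc d) N) ≡ + length (cells N) * + length (pairs d N)
  length-pairs-suc d N = begin
    + length (pairs (suc d) N)                    ≡⟨ ∑-1 (pairs (suc d) N) ⟨
    ∑[ p ∈ pairs (suc d) N ] (+ 1)                ≡⟨ ∑-pairs-suc d N _ ⟩
    ∑[ uv ∈ cells N ] ∑[ p ∈ pairs d N ] (+ 1)    ≡⟨ ∑-cong (λ _ → ∑-1 (pairs d N)) (cells N) ⟩
    ∑[ uv ∈ cells N ] (+ length (pairs d N))      ≡⟨ ∑-const _ (cells N) ⟩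
    + length (cells N) * + length (pairs d N)     ∎
    where open ≡-Reasoning

module IntegerBounds where

  open import Data.Nat as ℕ using (ℕ; suc)
  import Data.Nat.Properties as ℕ
  open import Data.Integer as ℤ using (ℤ; +_; -[1+_]; 0ℤ; _+_; _*_; _-_; -_; _≤_)
  import Data.Integer.Properties as ℤ
  open import Data.Product using (_×_; _,_)
  open import Relation.Binary.PropositionalEquality using (_≡_; refl; sym; trans; cong; subst; subst₂)

  square-abs : ∀ x → x * x ≡ + (ℤ.∣ x ∣ ℕ.* ℤ.∣ x ∣)
  square-abs (+ n)    = sym (ℤ.pos-* n n)
  square-abs -[1+ n ] = refl

  0≤x*x : ∀ x → 0ℤ ≤ x * x
  0≤x*x x = subst (0ℤ ≤_) (sym (square-abs x)) (ℤ.+≤+ ℕ.z≤n)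

  ≤-+₃ : ∀ {x y z} → 0ℤ ≤ x → 0ℤ ≤ y → 0ℤ ≤ z → x ≤ x + y + z × y ≤ x + y + z × z ≤ x + y + z
  ≤-+₃ {x} {y} {z} 0≤x 0≤y 0≤z =
    ℤ.≤-trans (ℤ.i≤i+j x y {{ℤ.nonNegative 0≤y}}) (ℤ.i≤i+j (x + y) z {{ℤ.nonNegative 0≤z}}) ,
    ℤ.≤-trans (ℤ.i≤j+i y x {{ℤ.nonNegative 0≤x}}) (ℤ.i≤i+j (x + y) z {{ℤ.nonNegative 0≤z}}) ,
    ℤ.i≤j+i z (x + y) {{ℤ.nonNegative (ℤ.+-mono-≤ 0≤x 0≤y)}}

  0≤i*j : ∀ i j → 0ℤ ≤ i → 0ℤ ≤ j → 0ℤ ≤ i * j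
  0≤i*j i j 0≤i 0≤j = ℤ.*-monoʳ-≤-nonNeg j {{ℤ.nonNegative 0≤j}} 0≤i

  0≤+*+*+ : ∀ a b c → 0ℤ ≤ + a * + b * + c
  0≤+*+*+ a b c = 0≤i*j (+ a * + b) (+ c) (0≤i*j (+ a) (+ b) (ℤ.+≤+ ℕ.z≤n) (ℤ.+≤+ ℕ.z≤n)) (ℤ.+≤+ ℕ.z≤n)

  difference-bounds : ∀ {i j m} → 0ℤ ≤ i → i ≤ m → 0ℤ ≤ j → j ≤ m → - m ≤ i - j × i - j ≤ m
  difference-bounds {i} {j} 0≤i i≤m 0≤j j≤m =
    ℤ.≤-trans (ℤ.neg-mono-≤ j≤m) (ℤ.i≤j⇒i≤k+j i {{ℤ.nonNegative 0≤i}} ℤ.≤-refl) ,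
    ℤ.≤-trans (ℤ.i-j≤i i j {{ℤ.nonNegative 0≤j}}) i≤m

  square-≤ : ∀ {x} m → - + m ≤ x → x ≤ + m → x * x ≤ + m * + m
  square-≤ {+ n} m _ (ℤ.+≤+ n≤m) =
    subst₂ _≤_ (ℤ.pos-* n n) (ℤ.pos-* m m) (ℤ.+≤+ (ℕ.*-mono-≤ n≤m n≤m))
  square-≤ { -[1+ n ]} m -m≤x _ with ℤ.+≤+ 1+n≤m ← ℤ.neg-cancel-≤ { + m} { + suc n} -m≤x =
    subst (+ (suc n ℕ.* suc n) ≤_) (ℤ.pos-* m m) (ℤ.+≤+ (ℕ.*-mono-≤ 1+n≤m 1+n≤m))

  square-≤⁻¹ : ∀ x m → x * x ≤ + m * + m → - + m ≤ x × x ≤ + m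
  square-≤⁻¹ x m x²≤m² = bounds x ∣x∣≤m
    where
    ∣x∣²≤m² : ℤ.∣ x ∣ ℕ.* ℤ.∣ x ∣ ℕ.≤ m ℕ.* m
    ∣x∣²≤m² = ℤ.drop‿+≤+ (subst₂ _≤_ (square-abs x) (sym (ℤ.pos-* m m)) x²≤m²)
    ∣x∣≤m : ℤ.∣ x ∣ ℕ.≤ m
    ∣x∣≤m = ℕ.≮⇒≥ (λ m<∣x∣ → ℕ.<⇒≱ (ℕ.*-mono-< m<∣x∣ m<∣x∣) ∣x∣²≤m²)
    bounds : ∀ x → ℤ.∣ x ∣ ℕ.≤ m → - + m ≤ x × x ≤ + m
    bounds (+ n)    n≤m   = ℤ.neg-≤-pos , ℤ.+≤+ n≤m
    bounds -[1+ n ] 1+n≤m = ℤ.neg-mono-≤ (ℤ.+≤+ 1+n≤m) , ℤ.-≤+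

module CoordinateSums where

  open import Data.Nat as ℕ using (ℕ; suc)
  import Data.Nat.Properties as ℕ
  open import Data.Integer as ℤ using (ℤ; +_; 0ℤ; _+_; _*_; _-_; -_; _≤_)
  import Data.Integer.Properties as ℤ
  open import Data.Integer.Tactic.RingSolver using (solve-∀)
  open import Data.List using (length)
  open import Data.List.Membership.Propositional using (_∈_)
  open import Data.Vec using (Vec; []; _∷_; toList)
  open import Data.Vec.Relation.Unary.All using (All; []; _∷_)
  open import Data.Product using (_×_; _,_; proj₁; proj₂)
  open import Relation.Binary.PropositionalEquality using (_≡_; sym; trans; cong; cong₂; subst; subst₂; module ≡-Reasoning)
  open FiniteSums
  open Lattice
  open IntegerBounds

  -- φ c (u , v) is the contribution of a coordinate in which a, w₁, w₂ have entries c, u, v.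
  Stat : Set
  Stat = ℕ → ℕ × ℕ → ℤ

  coordSum : ∀ {d} → Stat → Vec ℕ d → Vec ℕ d × Vec ℕ d → ℤ
  coordSum φ []      _                 = 0ℤ
  coordSum φ (c ∷ a) (u ∷ w₁ , v ∷ w₂) = φ c (u , v) + coordSum φ a (w₁ , w₂)

  ∑-coordSum-square-≤ : ∀ N (ψ : Stat) B →
    (∀ {c} → c ℕ.≤ N → ∑ (ψ c) (cells N) ≡ 0ℤ) →
    (∀ {c uv} → c ℕ.≤ N → uv ∈ cells N → ψ c uv * ψ c uv ≤ B) →
    ∀ {d} (a : Vec ℕ d) → All (ℕ._≤ N) a →
    ∑[ p ∈ pairs d N ] (coordSum ψ a p * coordSum ψ a p) ≤ + d * (+ length (pairs d N) * B)
  ∑-coordSum-square-≤ N ψ B centred bounded []      []              = ℤ.≤-refl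
  ∑-coordSum-square-≤ N ψ B centred bounded {suc d} (c ∷ a) (c≤N ∷ a≤N) = begin
    ∑[ p ∈ pairs (suc d) N ] (Z (c ∷ a) p * Z (c ∷ a) p)
      ≡⟨ ∑-pairs-suc d N _ ⟩
    ∑[ uv ∈ cells N ] ∑[ p ∈ P ] ((ψ c uv + Z a p) * (ψ c uv + Z a p))
      ≡⟨ ∑-∑-square (ψ c) (Z a) (cells N) P (centred c≤N) ⟩
    T * ∑[ uv ∈ cells N ] (ψ c uv * ψ c uv) + K * ∑[ p ∈ P ] (Z a p * Z a p)
      ≤⟨ ℤ.+-mono-≤ (ℤ.*-monoˡ-≤-nonNeg T cell-bound)
                    (ℤ.*-monoˡ-≤-nonNeg K (∑-coordSum-square-≤ N ψ B centred bounded a a≤N)) ⟩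
    T * (K * B) + K * (+ d * (T * B))
      ≡⟨ regroup T K B (+ d) ⟩
    (+ 1 + + d) * (K * T * B)
      ≡⟨ cong (λ n → + suc d * (n * B)) (length-pairs-suc d N) ⟨
    + suc d * (+ length (pairs (suc d) N) * B) ∎
    where
    open ℤ.≤-Reasoning
    Z : ∀ {n} → Vec ℕ n → Vec ℕ n × Vec ℕ n → ℤ
    Z = coordSum ψ
    P = pairs d N
    T = + length P
    K = + length (cells N)
    regroup : ∀ T K B d → T * (K * B) + K * (d * (T * B)) ≡ (+ 1 + d) * (K * T * B)
    regroup = solve-∀
    cell-bound : ∑[ uv ∈ cells N ] (ψ c uv * ψ c uv) ≤ K * B
    cell-bound = ℤ.≤-trans (∑-mono-≤ (cells N) (bounded c≤N)) (ℤ.≤-reflexive (∑-const B (cells N)))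

  cellSum : Stat → ℕ → ℕ → ℤ
  cellSum φ N c = ∑ (φ c) (cells N)

  -- (N + 1)² times the deviation of φ c from its mean over the cells, so as to stay in ℤ.
  centre : ℕ → Stat → Stat
  centre N φ c uv = + length (cells N) * φ c uv - cellSum φ N c

  ∑-centre : ∀ N φ c → ∑ (centre N φ c) (cells N) ≡ 0ℤ
  ∑-centre N φ c = begin
    ∑[ uv ∈ cells N ] (K * φ c uv - S)
      ≡⟨ ∑-+ (λ uv → K * φ c uv) (λ _ → - S) (cells N) ⟩
    ∑[ uv ∈ cells N ] (K * φ c uv) + ∑[ uv ∈ cells N ] (- S)
      ≡⟨ cong₂ _+_ (∑-*ˡ K (φ c) (cells N)) (∑-const (- S) (cells N)) ⟩
    K * S + K * - S
      ≡⟨ cancel K S ⟩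
    0ℤ ∎
    where
    open ≡-Reasoning
    K = + length (cells N)
    S = cellSum φ N c
    cancel : ∀ k s → k * s + k * - s ≡ 0ℤ
    cancel = solve-∀

  BoundedOn : ℕ → ℕ → Stat → Set
  BoundedOn N M φ = ∀ {c uv} → c ℕ.≤ N → uv ∈ cells N → 0ℤ ≤ φ c uv × φ c uv ≤ + M

  centre-square-≤ : ∀ N (φ : Stat) M → BoundedOn N M φ →
    let KM = length (cells N) ℕ.* M in
    ∀ {c uv} → c ℕ.≤ N → uv ∈ cells N → centre N φ c uv * centre N φ c uv ≤ + KM * + KM
  centre-square-≤ N φ M bounded {c} {uv} c≤N uv∈ = square-≤ KM (proj₁ bounds) (proj₂ bounds)
    where
    K = length (cells N)
    KM = K ℕ.* M
    K*M≡KM : + K * + M ≡ + KM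
    K*M≡KM = sym (ℤ.pos-* K M)
    scaled-bounds : 0ℤ ≤ + K * φ c uv × + K * φ c uv ≤ + KM
    scaled-bounds with 0≤φ , φ≤M ← bounded c≤N uv∈ =
      subst (_≤ + K * φ c uv) (ℤ.*-zeroʳ (+ K)) (ℤ.*-monoˡ-≤-nonNeg (+ K) 0≤φ) ,
      subst (+ K * φ c uv ≤_) K*M≡KM (ℤ.*-monoˡ-≤-nonNeg (+ K) φ≤M)
    sum-bounds : 0ℤ ≤ cellSum φ N c × cellSum φ N c ≤ + KM
    sum-bounds =
      ℤ.≤-trans (ℤ.≤-reflexive (sym (trans (∑-const 0ℤ (cells N)) (ℤ.*-zeroʳ (+ K)))))
                (∑-mono-≤ (cells N) (λ uv∈ → proj₁ (bounded c≤N uv∈))) ,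
      ℤ.≤-trans (∑-mono-≤ (cells N) (λ uv∈ → proj₂ (bounded c≤N uv∈)))
                (ℤ.≤-reflexive (trans (∑-const (+ M) (cells N)) K*M≡KM))
    bounds = difference-bounds (proj₁ scaled-bounds) (proj₂ scaled-bounds)
                               (proj₁ sum-bounds) (proj₂ sum-bounds)

  ∑-centred-square-≤ : ∀ N φ M → BoundedOn N M φ → ∀ {d} (a : Vec ℕ d) → All (ℕ._≤ N) a →
    let Z = coordSum (centre N φ) a ; KM = length (cells N) ℕ.* M in
    ∑[ p ∈ pairs d N ] (Z p * Z p) ≤ + d * (+ length (pairs d N) * (+ KM * + KM))
  ∑-centred-square-≤ N φ M bounded =
    ∑-coordSum-square-≤ N (centre N φ) _ (λ {c} _ → ∑-centre N φ c) (centre-square-≤ N φ M bounded)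

  coordSum-centre : ∀ N φ {d} (a : Vec ℕ d) p →
    coordSum (centre N φ) a p ≡ + length (cells N) * coordSum φ a p - ∑ (cellSum φ N) (toList a)
  coordSum-centre N φ []      _                 = sym (trans (ℤ.+-identityʳ _) (ℤ.*-zeroʳ (+ length (cells N))))
  coordSum-centre N φ (c ∷ a) (u ∷ w₁ , v ∷ w₂) =
    trans (cong (_+_ (centre N φ c (u , v))) (coordSum-centre N φ a (w₁ , w₂)))
          (regroup (+ length (cells N)) (φ c (u , v)) (cellSum φ N c) (coordSum φ a (w₁ , w₂)) _)
    where
    regroup : ∀ k f s F S → k * f - s + (k * F - S) ≡ k * (f + F) - (s + S)
    regroup = solve-∀

  centre-identity : ∀ N φ {d} (a : Vec ℕ d) p (M : ℤ) (r : ℕ) → let K = + length (cells N) in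
    + 12 * ∑ (cellSum φ N) (toList a) ≡ K * (M + + r * (+ d * + N)) →
    K * (+ 12 * coordSum φ a p - M) ≡ + 12 * coordSum (centre N φ) a p + + r * (K * + d * + N)
  centre-identity N φ {d} a p M r mean = begin
    K * (+ 12 * Φ - M)                                  ≡⟨ split K Φ M (+ r) (+ d) (+ N) ⟩
    + 12 * (K * Φ) - K * (M + + r * (+ d * + N)) + B    ≡⟨ cong (λ s → + 12 * (K * Φ) - s + B) mean ⟨
    + 12 * (K * Φ) - + 12 * S + B                       ≡⟨ cong (_+ B) (factor (K * Φ) S) ⟩
    + 12 * (K * Φ - S) + B                              ≡⟨ cong (λ z → + 12 * z + B) (coordSum-centre N φ a p) ⟨
    + 12 * coordSum (centre N φ) a p + B                ∎
    where
    open ≡-Reasoning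
    K = + length (cells N)
    B = + r * (K * + d * + N)
    Φ = coordSum φ a p
    S = ∑ (cellSum φ N) (toList a)
    split : ∀ K Φ M r d N → K * (+ 12 * Φ - M) ≡ + 12 * (K * Φ) - K * (M + r * (d * N)) + r * (K * d * N)
    split = solve-∀
    factor : ∀ x s → + 12 * x - + 12 * s ≡ + 12 * (x - s)
    factor = solve-∀

  -- The term r K d N, the bias of the exact mean, is absorbed using 2 kk ≤ N.
  deviation-≤ : ∀ K kk d N r {Z E} .{{_ : ℕ.NonZero K}} → let D = + d * + N * + N in
    + K * E ≤ + 12 * Z + + r * (+ K * + d * + N) → + 2 * + kk * Z ≤ + K * D → r ℕ.≤ 4 → 2 ℕ.* kk ℕ.≤ N →
    + kk * E ≤ + 12 * D
  deviation-≤ K@(suc _) kk d N r {Z} {E} KE≤ 2kkZ≤KD r≤4 2kk≤N = ℤ.*-cancelˡ-≤-pos _ _ (+ K) (begin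
    + K * (+ kk * E)                          ≡⟨ swap (+ K) (+ kk) E ⟩
    + kk * (+ K * E)                          ≤⟨ ℤ.*-monoˡ-≤-nonNeg (+ kk) KE≤ ⟩
    + kk * (+ 12 * Z + + r * X)               ≡⟨ regroup (+ kk) Z (+ r) X ⟩
    + 6 * (+ 2 * + kk * Z) + + r * + kk * X
      ≤⟨ ℤ.+-mono-≤ (ℤ.*-monoˡ-≤-nonNeg (+ 6) 2kkZ≤KD) (ℤ.*-monoʳ-≤-nonNeg X {{X≥0}} rkk≤2N) ⟩
    + 6 * (+ K * D) + + 2 * + N * X           ≡⟨ collect (+ K) (+ d) (+ N) ⟩
    + K * (+ 8 * D)                           ≤⟨ ℤ.*-monoˡ-≤-nonNeg (+ K) (ℤ.*-monoʳ-≤-nonNeg D {{D≥0}} (ℤ.+≤+ 8≤12)) ⟩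
    + K * (+ 12 * D)                          ∎)
    where
    open ℤ.≤-Reasoning
    X = + K * + d * + N
    D = + d * + N * + N
    X≥0 : ℤ.NonNegative X
    X≥0 = ℤ.nonNegative (0≤+*+*+ K d N)
    D≥0 : ℤ.NonNegative D
    D≥0 = ℤ.nonNegative (0≤+*+*+ d N N)
    8≤12 = ℕ.m≤m+n 8 4
    rkk≤2N : + r * + kk ≤ + 2 * + N
    rkk≤2N = subst₂ _≤_ (ℤ.pos-* r kk) (ℤ.pos-* 2 N) (ℤ.+≤+ (ℕ.≤-trans (ℕ.*-monoˡ-≤ kk r≤4)
               (ℕ.≤-trans (ℕ.≤-reflexive (ℕ.*-assoc 2 2 kk)) (ℕ.*-monoʳ-≤ 2 2kk≤N))))
    swap : ∀ a b c → a * (b * c) ≡ b * (a * c)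
    swap = solve-∀
    regroup : ∀ k z r x → k * (+ 12 * z + r * x) ≡ + 6 * (+ 2 * k * z) + r * k * x
    regroup = solve-∀
    collect : ∀ K d N → + 6 * (K * (d * N * N)) + + 2 * N * (K * d * N) ≡ K * (+ 8 * (d * N * N))
    collect = solve-∀

  deviation-bounds : ∀ K kk d N r {Z E} .{{_ : ℕ.NonZero K}} → let D = + d * + N * + N in
    + K * E ≡ + 12 * Z + + r * (+ K * + d * + N) →
    - (+ K * D) ≤ + 2 * + kk * Z → + 2 * + kk * Z ≤ + K * D → r ℕ.≤ 4 → 2 ℕ.* kk ℕ.≤ N →
    + kk * E ≤ + 12 * D × + kk * - E ≤ + 12 * D
  deviation-bounds K kk d N r {Z} {E} KE≡ -KD≤2kkZ 2kkZ≤KD r≤4 2kk≤N =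
    deviation-≤ K kk d N r (ℤ.≤-reflexive KE≡) 2kkZ≤KD r≤4 2kk≤N ,
    deviation-≤ K kk d N r {Z = - Z} {E = - E} K-E≤ 2kk-Z≤KD r≤4 2kk≤N
    where
    open ℤ.≤-Reasoning
    D = + d * + N * + N
    B = + r * (+ K * + d * + N)
    B≥0 : ℤ.NonNegative B
    B≥0 = ℤ.nonNegative (0≤i*j (+ r) (+ K * + d * + N) (ℤ.+≤+ ℕ.z≤n) (0≤+*+*+ K d N))
    K-E≤ : + K * - E ≤ + 12 * - Z + B
    K-E≤ = begin
      + K * - E                  ≡⟨ ℤ.neg-distribʳ-* (+ K) E ⟨
      - (+ K * E)                ≡⟨ cong -_ KE≡ ⟩
      - (+ 12 * Z + B)           ≡⟨ negate-sum Z B ⟩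
      + 12 * - Z - B             ≤⟨ ℤ.i-j≤i _ B {{B≥0}} ⟩
      + 12 * - Z                 ≤⟨ ℤ.i≤i+j _ B {{B≥0}} ⟩
      + 12 * - Z + B             ∎
      where
      negate-sum : ∀ z b → - (+ 12 * z + b) ≡ + 12 * - z - b
      negate-sum = solve-∀
    2kk-Z≤KD : + 2 * + kk * - Z ≤ + K * D
    2kk-Z≤KD = begin
      + 2 * + kk * - Z           ≡⟨ ℤ.neg-distribʳ-* (+ 2 * + kk) Z ⟨
      - (+ 2 * + kk * Z)         ≤⟨ ℤ.neg-mono-≤ -KD≤2kkZ ⟩
      - - (+ K * D)              ≡⟨ ℤ.neg-involutive (+ K * D) ⟩
      + K * D                    ∎

module SquaredDistances where

  open import Data.Nat as ℕ using (ℕ; zero; suc)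
  import Data.Nat.Properties as ℕ
  open import Data.Integer as ℤ using (ℤ; +_; 0ℤ; _+_; _*_; _-_; _≤_)
  import Data.Integer.Properties as ℤ
  open import Data.Integer.Tactic.RingSolver using (solve-∀)
  open import Data.List as List using (List; []; _∷_; _∷ʳ_; length; upTo)
  import Data.List.Properties as List
  open import Data.Vec using (Vec; []; _∷_; toList)
  import Data.Vec.Properties as Vec
  open import Data.Product using (_×_; _,_; proj₁; proj₂)
  open import Relation.Binary.PropositionalEquality using (_≡_; refl; sym; trans; cong; cong₂; subst₂; module ≡-Reasoning)
  open FiniteSums
  open Lattice
  open IntegerBounds
  open CoordinateSums

  sqDiff : ℕ → ℕ → ℤ
  sqDiff x y = + (absDiff x y ℕ.* absDiff x y)

  sqDiff≡ : ∀ x y → sqDiff x y ≡ (+ x - + y) * (+ x - + y)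
  sqDiff≡ zero    zero    = refl
  sqDiff≡ zero    (suc y) = refl
  sqDiff≡ (suc x) zero    = sym (ℤ.pos-* (suc x ℕ.+ 0) (suc x ℕ.+ 0))
  sqDiff≡ (suc x) (suc y) = trans (sqDiff≡ x y) (shift (+ x) (+ y))
    where
    shift : ∀ x y → (x - y) * (x - y) ≡ ((+ 1 + x) - (+ 1 + y)) * ((+ 1 + x) - (+ 1 + y))
    shift = solve-∀

  sqDiff-bounds : ∀ {N x y} → x ℕ.≤ N → y ℕ.≤ N → 0ℤ ≤ sqDiff x y × sqDiff x y ≤ + (N ℕ.* N)
  sqDiff-bounds {N} {x} {y} x≤N y≤N =
    ℤ.+≤+ ℕ.z≤n ,
    subst₂ _≤_ (sym (sqDiff≡ x y)) (sym (ℤ.pos-* N N))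
           (square-≤ N (proj₁ x-y-bounds) (proj₂ x-y-bounds))
    where
    x-y-bounds = difference-bounds (ℤ.+≤+ ℕ.z≤n) (ℤ.+≤+ x≤N) (ℤ.+≤+ ℕ.z≤n) (ℤ.+≤+ y≤N)

  ∑-upTo-square : ∀ e n → + 3 * ∑[ u ∈ upTo n ] ((e - + 2 * + u) * (e - + 2 * + u))
                          ≡ + n * (+ 3 * ((e - + n + + 1) * (e - + n + + 1)) + + n * + n - + 1)
  ∑-upTo-square e zero    = refl
  ∑-upTo-square e (suc n) = begin
    + 3 * ∑ f (upTo (suc n))                  ≡⟨ cong (λ xs → + 3 * ∑ f xs) (List.upTo-∷ʳ n) ⟨
    + 3 * ∑ f (upTo n ∷ʳ n)                   ≡⟨ cong (+ 3 *_) (∑-++ f (upTo n) (n ∷ [])) ⟩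
    + 3 * (∑ f (upTo n) + (f n + 0ℤ))         ≡⟨ distrib (∑ f (upTo n)) (f n) ⟩
    + 3 * ∑ f (upTo n) + + 3 * f n            ≡⟨ cong (_+ + 3 * f n) (∑-upTo-square e n) ⟩
    + n * (+ 3 * ((e - + n + + 1) * (e - + n + + 1)) + + n * + n - + 1) + + 3 * f n
                                              ≡⟨ step e (+ n) ⟩
    (+ 1 + + n) * (+ 3 * ((e - (+ 1 + + n) + + 1) * (e - (+ 1 + + n) + + 1)) + (+ 1 + + n) * (+ 1 + + n) - + 1) ∎
    where
    open ≡-Reasoning
    f : ℕ → ℤ
    f u = (e - + 2 * + u) * (e - + 2 * + u)
    distrib : ∀ s t → + 3 * (s + (t + 0ℤ)) ≡ + 3 * s + + 3 * t
    distrib = solve-∀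
    step : ∀ e n → n * (+ 3 * ((e - n + + 1) * (e - n + + 1)) + n * n - + 1) + + 3 * ((e - + 2 * n) * (e - + 2 * n))
                 ≡ (+ 1 + n) * (+ 3 * ((e - (+ 1 + n) + + 1) * (e - (+ 1 + n) + + 1)) + (+ 1 + n) * (+ 1 + n) - + 1)
    step = solve-∀

  ∑-sqDiff : ∀ N c → + 12 * ∑[ v ∈ upTo (suc N) ] sqDiff c v
                     ≡ + suc N * (+ 3 * ((+ 2 * + c - + N) * (+ 2 * + c - + N)) + + suc N * + suc N - + 1)
  ∑-sqDiff N c = begin
    + 12 * ∑[ v ∈ upTo (suc N) ] sqDiff c v
      ≡⟨ cong (+ 12 *_) (∑-cong (sqDiff≡ c) (upTo (suc N))) ⟩
    + 12 * ∑[ v ∈ upTo (suc N) ] ((+ c - + v) * (+ c - + v))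
      ≡⟨ trans (twelve=3*4 _) (cong (+ 3 *_) (sym (∑-*ˡ (+ 4) (λ v → (+ c - + v) * (+ c - + v)) (upTo (suc N))))) ⟩
    + 3 * ∑[ v ∈ upTo (suc N) ] (+ 4 * ((+ c - + v) * (+ c - + v)))
      ≡⟨ cong (+ 3 *_) (∑-cong (λ v → double (+ c) (+ v)) (upTo (suc N))) ⟩
    + 3 * ∑[ v ∈ upTo (suc N) ] ((+ 2 * + c - + 2 * + v) * (+ 2 * + c - + 2 * + v))
      ≡⟨ ∑-upTo-square (+ 2 * + c) (suc N) ⟩
    + suc N * (+ 3 * ((+ 2 * + c - + suc N + + 1) * (+ 2 * + c - + suc N + + 1)) + + suc N * + suc N - + 1)
      ≡⟨ cong (λ t → + suc N * (+ 3 * (t * t) + + suc N * + suc N - + 1)) (shift (+ 2 * + c) (+ N)) ⟩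
    + suc N * (+ 3 * ((+ 2 * + c - + N) * (+ 2 * + c - + N)) + + suc N * + suc N - + 1) ∎
    where
    open ≡-Reasoning
    twelve=3*4 : ∀ s → + 12 * s ≡ + 3 * (+ 4 * s)
    twelve=3*4 = solve-∀
    double : ∀ c v → + 4 * ((c - v) * (c - v)) ≡ (+ 2 * c - + 2 * v) * (+ 2 * c - + 2 * v)
    double = solve-∀
    shift : ∀ e N → e - (+ 1 + N) + + 1 ≡ e - N
    shift = solve-∀

  d²-w₁w₂ d²-aw₁ d²-aw₂ : Stat
  d²-w₁w₂ _ (u , v) = sqDiff u v
  d²-aw₁  c (u , _) = sqDiff c u
  d²-aw₂  c (_ , v) = sqDiff c v

  cellSum-d²-w₁w₂ : ∀ N c → let L = + suc N in
    + 12 * cellSum d²-w₁w₂ N c ≡ + 2 * (L * L) * (L * L - + 1)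
  cellSum-d²-w₁w₂ N c = begin
    + 12 * ∑ (d²-w₁w₂ c) (cells N)
      ≡⟨ cong (+ 12 *_) (∑-cartesianProduct (d²-w₁w₂ c) U U) ⟩
    + 12 * ∑[ u ∈ U ] ∑[ v ∈ U ] sqDiff u v
      ≡⟨ ∑-*ˡ (+ 12) (λ u → ∑[ v ∈ U ] sqDiff u v) U ⟨
    ∑[ u ∈ U ] (+ 12 * ∑[ v ∈ U ] sqDiff u v)
      ≡⟨ ∑-cong (λ u → trans (∑-sqDiff N u) (regroup L (+ u) (+ N))) U ⟩
    ∑[ u ∈ U ] (L * + 3 * f u + L * (L * L - + 1))
      ≡⟨ ∑-linear (L * + 3) (L * (L * L - + 1)) f U ⟩
    L * + 3 * ∑ f U + + length U * (L * (L * L - + 1))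
      ≡⟨ cong₂ (λ s l → s + + l * (L * (L * L - + 1))) (ℤ.*-assoc L (+ 3) (∑ f U)) (List.length-upTo (suc N)) ⟩
    L * (+ 3 * ∑ f U) + L * (L * (L * L - + 1))
      ≡⟨ cong (λ s → L * s + L * (L * (L * L - + 1))) (∑-upTo-square (+ N) (suc N)) ⟩
    L * (L * (+ 3 * ((+ N - L + + 1) * (+ N - L + + 1)) + L * L - + 1)) + L * (L * (L * L - + 1))
      ≡⟨ collect (+ N) ⟩
    + 2 * (L * L) * (L * L - + 1) ∎
    where
    open ≡-Reasoning
    U = upTo (suc N)
    L = + suc N
    f : ℕ → ℤ
    f u = (+ N - + 2 * + u) * (+ N - + 2 * + u)
    regroup : ∀ L u N → L * (+ 3 * ((+ 2 * u - N) * (+ 2 * u - N)) + L * L - + 1)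
                      ≡ L * + 3 * ((N - + 2 * u) * (N - + 2 * u)) + L * (L * L - + 1)
    regroup = solve-∀
    collect : ∀ N → let L = + 1 + N in
      L * (L * (+ 3 * ((N - L + + 1) * (N - L + + 1)) + L * L - + 1)) + L * (L * (L * L - + 1))
        ≡ + 2 * (L * L) * (L * L - + 1)
    collect = solve-∀

  scaled-∑-sqDiff : ∀ N c → let L = + suc N in
    + 12 * (L * ∑ (sqDiff c) (upTo (suc N))) ≡ L * L * (+ 3 * ((+ 2 * + c - + N) * (+ 2 * + c - + N)) + L * L - + 1)
  scaled-∑-sqDiff N c = begin
    + 12 * (L * ∑ (sqDiff c) (upTo (suc N)))     ≡⟨ swap (+ 12) L _ ⟩
    L * (+ 12 * ∑ (sqDiff c) (upTo (suc N)))     ≡⟨ cong (L *_) (∑-sqDiff N c) ⟩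
    L * (L * (+ 3 * ((+ 2 * + c - + N) * (+ 2 * + c - + N)) + L * L - + 1))
                                                 ≡⟨ ℤ.*-assoc L L _ ⟨
    L * L * (+ 3 * ((+ 2 * + c - + N) * (+ 2 * + c - + N)) + L * L - + 1) ∎
    where
    open ≡-Reasoning
    L = + suc N
    swap : ∀ a b s → a * (b * s) ≡ b * (a * s)
    swap = solve-∀

  cellSum-d²-aw₁ : ∀ N c → let L = + suc N in
    + 12 * cellSum d²-aw₁ N c ≡ L * L * (+ 3 * ((+ 2 * + c - + N) * (+ 2 * + c - + N)) + L * L - + 1)
  cellSum-d²-aw₁ N c = trans (cong (+ 12 *_) row-sum) (scaled-∑-sqDiff N c)
    where
    U = upTo (suc N)
    row-sum : cellSum d²-aw₁ N c ≡ + suc N * ∑ (sqDiff c) U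
    row-sum = begin
      ∑ (d²-aw₁ c) (cells N)              ≡⟨ ∑-cartesianProduct (d²-aw₁ c) U U ⟩
      ∑[ u ∈ U ] ∑[ v ∈ U ] sqDiff c u    ≡⟨ ∑-cong (λ u → ∑-const (sqDiff c u) U) U ⟩
      ∑[ u ∈ U ] (+ length U * sqDiff c u) ≡⟨ ∑-*ˡ (+ length U) (sqDiff c) U ⟩
      + length U * ∑ (sqDiff c) U         ≡⟨ cong (λ l → + l * ∑ (sqDiff c) U) (List.length-upTo (suc N)) ⟩
      + suc N * ∑ (sqDiff c) U            ∎
      where open ≡-Reasoning

  cellSum-d²-aw₂ : ∀ N c → let L = + suc N in
    + 12 * cellSum d²-aw₂ N c ≡ L * L * (+ 3 * ((+ 2 * + c - + N) * (+ 2 * + c - + N)) + L * L - + 1)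
  cellSum-d²-aw₂ N c = trans (cong (+ 12 *_) row-sum) (scaled-∑-sqDiff N c)
    where
    U = upTo (suc N)
    row-sum : cellSum d²-aw₂ N c ≡ + suc N * ∑ (sqDiff c) U
    row-sum = begin
      ∑ (d²-aw₂ c) (cells N)              ≡⟨ ∑-cartesianProduct (d²-aw₂ c) U U ⟩
      ∑[ u ∈ U ] ∑[ v ∈ U ] sqDiff c v    ≡⟨ ∑-const (∑ (sqDiff c) U) U ⟩
      + length U * ∑ (sqDiff c) U         ≡⟨ cong (λ l → + l * ∑ (sqDiff c) U) (List.length-upTo (suc N)) ⟩
      + suc N * ∑ (sqDiff c) U            ∎
      where open ≡-Reasoning

  coordSum-d²-w₁w₂ : ∀ {d} (a w₁ w₂ : Vec ℕ d) → coordSum d²-w₁w₂ a (w₁ , w₂) ≡ + sqDist w₁ w₂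
  coordSum-d²-w₁w₂ []      []       []       = refl
  coordSum-d²-w₁w₂ (c ∷ a) (u ∷ w₁) (v ∷ w₂) =
    trans (cong (_+_ (sqDiff u v)) (coordSum-d²-w₁w₂ a w₁ w₂)) (sym (ℤ.pos-+ _ (sqDist w₁ w₂)))

  coordSum-d²-aw₁ : ∀ {d} (a w₁ w₂ : Vec ℕ d) → coordSum d²-aw₁ a (w₁ , w₂) ≡ + sqDist a w₁
  coordSum-d²-aw₁ []      []       []       = refl
  coordSum-d²-aw₁ (c ∷ a) (u ∷ w₁) (v ∷ w₂) =
    trans (cong (_+_ (sqDiff c u)) (coordSum-d²-aw₁ a w₁ w₂)) (sym (ℤ.pos-+ _ (sqDist a w₁)))

  coordSum-d²-aw₂ : ∀ {d} (a w₁ w₂ : Vec ℕ d) → coordSum d²-aw₂ a (w₁ , w₂) ≡ + sqDist a w₂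
  coordSum-d²-aw₂ []      []       []       = refl
  coordSum-d²-aw₂ (c ∷ a) (u ∷ w₁) (v ∷ w₂) =
    trans (cong (_+_ (sqDiff c v)) (coordSum-d²-aw₂ a w₁ w₂)) (sym (ℤ.pos-+ _ (sqDist a w₂)))

  sqDev≡∑ : ∀ N {d} (a : Vec ℕ d) → + sqDev N a ≡ ∑[ c ∈ toList a ] ((+ 2 * + c - + N) * (+ 2 * + c - + N))
  sqDev≡∑ N []      = refl
  sqDev≡∑ N (c ∷ a) = trans (ℤ.pos-+ _ (sqDev N a)) (cong₂ _+_ first-term (sqDev≡∑ N a))
    where
    first-term : sqDiff (2 ℕ.* c) N ≡ (+ 2 * + c - + N) * (+ 2 * + c - + N)
    first-term = trans (sqDiff≡ (2 ℕ.* c) N) (cong (λ t → (t - + N) * (t - + N)) (ℤ.pos-* 2 c))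

  length-cells-ℤ : ∀ N → + length (cells N) ≡ + suc N * + suc N
  length-cells-ℤ N = trans (cong +_ (length-cells N)) (ℤ.pos-* (suc N) (suc N))

  mean-d²-w₁w₂ : ∀ N {d} (a : Vec ℕ d) →
    + 12 * ∑ (cellSum d²-w₁w₂ N) (toList a)
      ≡ + length (cells N) * (+ 2 * (+ d * + N * + N) + + 4 * (+ d * + N))
  mean-d²-w₁w₂ N {d} a = begin
    + 12 * ∑ (cellSum d²-w₁w₂ N) (toList a)
      ≡⟨ ∑-*ˡ (+ 12) (cellSum d²-w₁w₂ N) (toList a) ⟨
    ∑[ c ∈ toList a ] (+ 12 * cellSum d²-w₁w₂ N c)
      ≡⟨ ∑-cong (cellSum-d²-w₁w₂ N) (toList a) ⟩
    ∑[ c ∈ toList a ] (+ 2 * (L * L) * (L * L - + 1))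
      ≡⟨ ∑-const _ (toList a) ⟩
    + List.length (toList a) * (+ 2 * (L * L) * (L * L - + 1))
      ≡⟨ cong (λ n → + n * (+ 2 * (L * L) * (L * L - + 1))) (Vec.length-toList a) ⟩
    + d * (+ 2 * (L * L) * (L * L - + 1))
      ≡⟨ expand (+ d) (+ N) ⟩
    L * L * (+ 2 * (+ d * + N * + N) + + 4 * (+ d * + N))
      ≡⟨ cong (λ k → k * (+ 2 * (+ d * + N * + N) + + 4 * (+ d * + N))) (length-cells-ℤ N) ⟨
    + length (cells N) * (+ 2 * (+ d * + N * + N) + + 4 * (+ d * + N)) ∎
    where
    open ≡-Reasoning
    L = + suc N
    expand : ∀ d N → let L = + 1 + N in d * (+ 2 * (L * L) * (L * L - + 1)) ≡ L * L * (+ 2 * (d * N * N) + + 4 * (d * N))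
    expand = solve-∀

  mean-d²-a : ∀ N φ → (∀ c → + 12 * cellSum φ N c
                            ≡ + suc N * + suc N * (+ 3 * ((+ 2 * + c - + N) * (+ 2 * + c - + N)) + + suc N * + suc N - + 1)) →
    ∀ {d} (a : Vec ℕ d) →
    + 12 * ∑ (cellSum φ N) (toList a)
      ≡ + length (cells N) * ((+ d * + N * + N + + 3 * + sqDev N a) + + 2 * (+ d * + N))
  mean-d²-a N φ cellSum-φ {d} a = begin
    + 12 * ∑ (cellSum φ N) (toList a)
      ≡⟨ ∑-*ˡ (+ 12) (cellSum φ N) (toList a) ⟨
    ∑[ c ∈ toList a ] (+ 12 * cellSum φ N c)
      ≡⟨ ∑-cong (λ c → trans (cellSum-φ c) (regroup L (+ c) (+ N))) (toList a) ⟩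
    ∑[ c ∈ toList a ] (L * L * + 3 * g c + L * L * (L * L - + 1))
      ≡⟨ ∑-linear (L * L * + 3) (L * L * (L * L - + 1)) g (toList a) ⟩
    L * L * + 3 * ∑ g (toList a) + + List.length (toList a) * (L * L * (L * L - + 1))
      ≡⟨ cong₂ (λ s n → L * L * + 3 * s + + n * (L * L * (L * L - + 1))) (sym (sqDev≡∑ N a)) (Vec.length-toList a) ⟩
    L * L * + 3 * + sqDev N a + + d * (L * L * (L * L - + 1))
      ≡⟨ expand (+ d) (+ N) (+ sqDev N a) ⟩
    L * L * ((+ d * + N * + N + + 3 * + sqDev N a) + + 2 * (+ d * + N))
      ≡⟨ cong (λ k → k * ((+ d * + N * + N + + 3 * + sqDev N a) + + 2 * (+ d * + N))) (length-cells-ℤ N) ⟨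
    + length (cells N) * ((+ d * + N * + N + + 3 * + sqDev N a) + + 2 * (+ d * + N)) ∎
    where
    open ≡-Reasoning
    L = + suc N
    g : ℕ → ℤ
    g c = (+ 2 * + c - + N) * (+ 2 * + c - + N)
    regroup : ∀ L c N → L * L * (+ 3 * ((+ 2 * c - N) * (+ 2 * c - N)) + L * L - + 1)
                      ≡ L * L * + 3 * ((+ 2 * c - N) * (+ 2 * c - N)) + L * L * (L * L - + 1)
    regroup = solve-∀
    expand : ∀ d N s → let L = + 1 + N in
      L * L * + 3 * s + d * (L * L * (L * L - + 1)) ≡ L * L * ((d * N * N + + 3 * s) + + 2 * (d * N))
    expand = solve-∀

  bounded-d²-w₁w₂ : ∀ N → BoundedOn N (N ℕ.* N) d²-w₁w₂
  bounded-d²-w₁w₂ N {uv = u , v} _ uv∈ = sqDiff-bounds (proj₁ (∈-cells⁻ N uv∈)) (proj₂ (∈-cells⁻ N uv∈))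

  bounded-d²-aw₁ : ∀ N → BoundedOn N (N ℕ.* N) d²-aw₁
  bounded-d²-aw₁ N {uv = u , v} c≤N uv∈ = sqDiff-bounds c≤N (proj₁ (∈-cells⁻ N uv∈))

  bounded-d²-aw₂ : ∀ N → BoundedOn N (N ℕ.* N) d²-aw₂
  bounded-d²-aw₂ N {uv = u , v} c≤N uv∈ = sqDiff-bounds c≤N (proj₂ (∈-cells⁻ N uv∈))

module Fractions where

  open import Data.Bool using (T)
  open import Data.Bool.Properties using (T-∨; T-∧)
  open import Data.Nat as ℕ using (ℕ; zero; suc; NonZero)
  import Data.Nat.Properties as ℕ
  open import Data.Integer as ℤ using (ℤ; +_; -[1+_]; 0ℤ)
  import Data.Integer.Properties as ℤ
  open import Data.Integer.Tactic.RingSolver using (solve-∀)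
  open import Data.Rational using (ℚ; mkℚ; _/_; _+_; _-_; _*_; -_; _≤_; _<_; 0ℚ; 1ℚ; toℚᵘ; *<*; NonNegative; nonNegative)
  import Data.Rational.Properties as ℚ
  open import Data.Rational.Solver using (module +-*-Solver)
  open import Data.Rational.Unnormalised as ℚᵘ using (mkℚᵘ) renaming (_≃_ to _≃ᵘ_)
  import Data.Rational.Unnormalised.Properties as ℚᵘ
  open import Data.Product using (Σ; _×_; _,_)
  open import Data.Sum using (inj₁)
  open import Function.Bundles using (Equivalence)
  open import Relation.Binary.PropositionalEquality using (_≡_; refl; sym; trans; cong; subst)

  infix 4 _≈[_]_
  _≈[_]_ : ℚ → ℚ → ℚ → Set
  x ≈[ δ ] y = x ≤ y + δ × y ≤ x + δ

  toℚᵘ-/ : ∀ i m .{{_ : NonZero m}} → toℚᵘ (i / m) ≃ᵘ i ℚᵘ./ m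
  toℚᵘ-/ i (suc m) = ℚ.toℚᵘ-fromℚᵘ (mkℚᵘ i m)

  /-≤-/ : ∀ i j m n .{{_ : NonZero m}} .{{_ : NonZero n}} → i ℤ.* + n ℤ.≤ j ℤ.* + m → i / m ≤ j / n
  /-≤-/ i j m@(suc _) n@(suc _) h =
    ℚ.toℚᵘ-cancel-≤ (ℚᵘ.≤-respˡ-≃ (ℚᵘ.≃-sym (toℚᵘ-/ i m))
                    (ℚᵘ.≤-respʳ-≃ (ℚᵘ.≃-sym (toℚᵘ-/ j n)) (ℚᵘ.*≤* h)))

  /-+-/ : ∀ i j m n .{{_ : NonZero m}} .{{_ : NonZero n}} →
    i / m + j / n ≡ _/_ (i ℤ.* + n ℤ.+ j ℤ.* + m) (m ℕ.* n) {{ℕ.m*n≢0 m n}}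
  /-+-/ i j m@(suc _) n@(suc _) = ℚ.toℚᵘ-injective (ℚᵘ.≃-trans (ℚ.toℚᵘ-homo-+ (i / m) (j / n))
    (ℚᵘ.≃-trans (ℚᵘ.+-cong (toℚᵘ-/ i m) (toℚᵘ-/ j n)) (ℚᵘ.≃-sym (toℚᵘ-/ _ (m ℕ.* n)))))

  /-*-/ : ∀ i j m n .{{_ : NonZero m}} .{{_ : NonZero n}} →
    (i / m) * (j / n) ≡ _/_ (i ℤ.* j) (m ℕ.* n) {{ℕ.m*n≢0 m n}}
  /-*-/ i j m@(suc _) n@(suc _) = ℚ.toℚᵘ-injective (ℚᵘ.≃-trans (ℚ.toℚᵘ-homo-* (i / m) (j / n))
    (ℚᵘ.≃-trans (ℚᵘ.*-cong (toℚᵘ-/ i m) (toℚᵘ-/ j n)) (ℚᵘ.≃-sym (toℚᵘ-/ _ (m ℕ.* n)))))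

  k[in-jm]≤mn⇒i/m≤j/n+1/k : ∀ i j m n k .{{_ : NonZero m}} .{{_ : NonZero n}} .{{_ : NonZero k}} →
    + k ℤ.* (i ℤ.* + n ℤ.- j ℤ.* + m) ℤ.≤ + m ℤ.* + n → i / m ≤ j / n + + 1 / k
  k[in-jm]≤mn⇒i/m≤j/n+1/k i j m@(suc _) n@(suc _) k@(suc _) h =
    subst (i / m ≤_) (sym (/-+-/ j (+ 1) n k)) (/-≤-/ i (j ℤ.* + k ℤ.+ + 1 ℤ.* + n) m (n ℕ.* k) cross)
    where
    slack = + m ℤ.* + n ℤ.- + k ℤ.* (i ℤ.* + n ℤ.- j ℤ.* + m)
    slack≥0 = ℤ.nonNegative (ℤ.i≤j⇒0≤j-i h)
    rearrange : ∀ i j m n k →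
      i ℤ.* (n ℤ.* k) ≡ (j ℤ.* k ℤ.+ + 1 ℤ.* n) ℤ.* m ℤ.- (m ℤ.* n ℤ.- k ℤ.* (i ℤ.* n ℤ.- j ℤ.* m))
    rearrange = solve-∀
    cross : i ℤ.* + (n ℕ.* k) ℤ.≤ (j ℤ.* + k ℤ.+ + 1 ℤ.* + n) ℤ.* + m
    cross = begin
      i ℤ.* + (n ℕ.* k)                                  ≡⟨ cong (i ℤ.*_) (ℤ.pos-* n k) ⟩
      i ℤ.* (+ n ℤ.* + k)                                ≡⟨ rearrange i j (+ m) (+ n) (+ k) ⟩
      (j ℤ.* + k ℤ.+ + 1 ℤ.* + n) ℤ.* + m ℤ.- slack      ≤⟨ ℤ.i-j≤i _ slack {{slack≥0}} ⟩
      (j ℤ.* + k ℤ.+ + 1 ℤ.* + n) ℤ.* + m                ∎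
      where open ℤ.≤-Reasoning

  close-by-scaling : ∀ i j m n k (c E B : ℤ) .{{_ : NonZero m}} .{{_ : NonZero n}} .{{_ : NonZero k}} →
    0ℤ ℤ.≤ c → i ℤ.* + n ℤ.- j ℤ.* + m ≡ c ℤ.* E → + m ℤ.* + n ≡ c ℤ.* B →
    + k ℤ.* E ℤ.≤ B → + k ℤ.* ℤ.- E ℤ.≤ B → i / m ≈[ + 1 / k ] j / n
  close-by-scaling i j m n k c E B 0≤c cross mn kE≤B k-E≤B =
    k[in-jm]≤mn⇒i/m≤j/n+1/k i j m n k (begin
      + k ℤ.* (i ℤ.* + n ℤ.- j ℤ.* + m)     ≡⟨ cong (+ k ℤ.*_) cross ⟩
      + k ℤ.* (c ℤ.* E)                     ≡⟨ swap (+ k) c E ⟩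
      c ℤ.* (+ k ℤ.* E)                     ≤⟨ ℤ.*-monoˡ-≤-nonNeg c {{ℤ.nonNegative 0≤c}} kE≤B ⟩
      c ℤ.* B                               ≡⟨ mn ⟨
      + m ℤ.* + n                           ∎) ,
    k[in-jm]≤mn⇒i/m≤j/n+1/k j i n m k (begin
      + k ℤ.* (j ℤ.* + m ℤ.- i ℤ.* + n)     ≡⟨ cong (+ k ℤ.*_) (flip (i ℤ.* + n) (j ℤ.* + m)) ⟩
      + k ℤ.* ℤ.- (i ℤ.* + n ℤ.- j ℤ.* + m) ≡⟨ cong (λ x → + k ℤ.* ℤ.- x) cross ⟩
      + k ℤ.* ℤ.- (c ℤ.* E)                 ≡⟨ swap⁻ (+ k) c E ⟩
      c ℤ.* (+ k ℤ.* ℤ.- E)                 ≤⟨ ℤ.*-monoˡ-≤-nonNeg c {{ℤ.nonNegative 0≤c}} k-E≤B ⟩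
      c ℤ.* B                               ≡⟨ mn ⟨
      + m ℤ.* + n                           ≡⟨ ℤ.*-comm (+ m) (+ n) ⟩
      + n ℤ.* + m                           ∎)
    where
    open ℤ.≤-Reasoning
    swap : ∀ k c e → k ℤ.* (c ℤ.* e) ≡ c ℤ.* (k ℤ.* e)
    swap = solve-∀
    swap⁻ : ∀ k c e → k ℤ.* ℤ.- (c ℤ.* e) ≡ c ℤ.* (k ℤ.* ℤ.- e)
    swap⁻ = solve-∀
    flip : ∀ x y → y ℤ.- x ≡ ℤ.- (x ℤ.- y)
    flip = solve-∀

  sqrtLe-of-≤ : ∀ x y ε → x ≤ y + ε * ε → T (sqrtLe x y ε)
  sqrtLe-of-≤ x y ε x≤y+εε = Equivalence.from T-∨ (inj₁ (ℚ.≤⇒≤ᵇ (begin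
    x - y - ε * ε                    ≤⟨ ℚ.+-monoˡ-≤ (- (ε * ε)) (ℚ.+-monoˡ-≤ (- y) x≤y+εε) ⟩
    y + ε * ε - y - ε * ε            ≡⟨ cancel y (ε * ε) ⟩
    0ℚ                               ∎)))
    where
    open ℚ.≤-Reasoning
    cancel : ∀ a b → a + b - a - b ≡ 0ℚ
    cancel = solve 2 (λ a b → a :+ b :- a :- b := con 0ℚ) refl
      where open +-*-Solver

  sqrtClose-of-≈ : ∀ {x y q} ε → x ≈[ q ] y → q ≤ ε * ε → T (sqrtClose x y ε)
  sqrtClose-of-≈ {x} {y} ε (x≤y+q , y≤x+q) q≤εε = Equivalence.from T-∧
    ( sqrtLe-of-≤ x y ε (ℚ.≤-trans x≤y+q (ℚ.+-monoʳ-≤ y q≤εε))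
    , sqrtLe-of-≤ y x ε (ℚ.≤-trans y≤x+q (ℚ.+-monoʳ-≤ x q≤εε)))

  ∃1/[1+k]≤ : ∀ ε → 0ℚ < ε → Σ ℕ λ k-1 → + 1 / suc k-1 ≤ ε
  ∃1/[1+k]≤ (mkℚ (+ suc n) k-1 _) _ =
    k-1 , ℚ.toℚᵘ-cancel-≤ (ℚᵘ.≤-respˡ-≃ (ℚᵘ.≃-sym (toℚᵘ-/ (+ 1) (suc k-1)))
                            (ℚᵘ.*≤* (ℤ.*-monoʳ-≤-nonNeg (+ suc k-1) (ℤ.+≤+ {1} {suc n} (ℕ.s≤s ℕ.z≤n)))))
  ∃1/[1+k]≤ (mkℚ (+ zero)   _ _) (*<* (ℤ.+<+ ()))
  ∃1/[1+k]≤ (mkℚ -[1+ _ ]   _ _) (*<* ())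

  -- 1ℚ - + 1 / k unfolds to + 1 / 1 + -[1+ 0 ] / k.
  kT≤kG+T⇒[1-1/k]T≤G : ∀ k T G .{{_ : NonZero k}} →
    + k ℤ.* + T ℤ.≤ + k ℤ.* + G ℤ.+ + T → (1ℚ - + 1 / k) * toℚ T ≤ toℚ G
  kT≤kG+T⇒[1-1/k]T≤G k@(suc _) T G h =
    subst (_≤ toℚ G) (sym as-fraction) (/-≤-/ (k-1 ℤ.* + T) (+ G) (1 ℕ.* k ℕ.* 1) 1 cross)
    where
    k-1 = + 1 ℤ.* + k ℤ.+ -[1+ 0 ] ℤ.* + 1
    as-fraction : (1ℚ - + 1 / k) * toℚ T ≡ (k-1 ℤ.* + T) / (1 ℕ.* k ℕ.* 1)
    as-fraction = trans (cong (_* toℚ T) (/-+-/ (+ 1) -[1+ 0 ] 1 k)) (/-*-/ k-1 (+ T) (1 ℕ.* k) 1)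
    rearrange : ∀ k T G → (+ 1 ℤ.* k ℤ.+ -[1+ 0 ] ℤ.* + 1) ℤ.* T ℤ.* + 1 ℤ.+ (k ℤ.* G ℤ.+ T ℤ.- k ℤ.* T)
                          ≡ G ℤ.* (+ 1 ℤ.* k ℤ.* + 1)
    rearrange = solve-∀
    cross : k-1 ℤ.* + T ℤ.* + 1 ℤ.≤ + G ℤ.* + (1 ℕ.* k ℕ.* 1)
    cross = begin
      k-1 ℤ.* + T ℤ.* + 1                                          ≤⟨ ℤ.i≤i+j _ _ {{ℤ.nonNegative (ℤ.i≤j⇒0≤j-i h)}} ⟩
      k-1 ℤ.* + T ℤ.* + 1 ℤ.+ (+ k ℤ.* + G ℤ.+ + T ℤ.- + k ℤ.* + T) ≡⟨ rearrange (+ k) (+ T) (+ G) ⟩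
      + G ℤ.* (+ 1 ℤ.* + k ℤ.* + 1)
        ≡⟨ cong (+ G ℤ.*_) (trans (cong (ℤ._* + 1) (ℤ.pos-* 1 k)) (ℤ.pos-* (1 ℕ.* k) 1)) ⟨
      + G ℤ.* + (1 ℕ.* k ℕ.* 1)                                    ∎
      where open ℤ.≤-Reasoning

  1/k≤ε⇒1/k²≤ε² : ∀ k ε .{{_ : NonZero k}} → + 1 / k ≤ ε → _/_ (+ 1) (k ℕ.* k) {{ℕ.m*n≢0 k k}} ≤ ε * ε
  1/k≤ε⇒1/k²≤ε² k@(suc _) ε 1/k≤ε = begin
    + 1 / (k ℕ.* k)           ≡⟨ /-*-/ (+ 1) (+ 1) k k ⟨
    (+ 1 / k) * (+ 1 / k)     ≤⟨ ℚ.*-monoˡ-≤-nonNeg (+ 1 / k) {{1/k≥0}} 1/k≤ε ⟩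
    (+ 1 / k) * ε             ≤⟨ ℚ.*-monoʳ-≤-nonNeg ε {{ε≥0}} 1/k≤ε ⟩
    ε * ε                     ∎
    where
    open ℚ.≤-Reasoning
    1/k≥0 : NonNegative (+ 1 / k)
    1/k≥0 = ℚ.normalize-nonNeg 1 k
    ε≥0 : NonNegative ε
    ε≥0 = nonNegative (ℚ.≤-trans (ℚ.nonNegative⁻¹ (+ 1 / k) {{1/k≥0}}) 1/k≤ε)

  kT≤kG+T⇒[1-ε]T≤G : ∀ k T G ε .{{_ : NonZero k}} → + 1 / k ≤ ε →
    + k ℤ.* + T ℤ.≤ + k ℤ.* + G ℤ.+ + T → (1ℚ - ε) * toℚ T ≤ toℚ G
  kT≤kG+T⇒[1-ε]T≤G k T G ε 1/k≤ε count = ℚ.≤-trans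
    (ℚ.*-monoʳ-≤-nonNeg (toℚ T) {{ℚ.normalize-nonNeg T 1}} (ℚ.+-monoʳ-≤ 1ℚ (ℚ.neg-antimono-≤ 1/k≤ε)))
    (kT≤kG+T⇒[1-1/k]T≤G k T G count)

module Estimate (k-1 d-1 N-1 : ℕ) where

  open import Data.Nat as ℕ using (suc)
  import Data.Nat.Properties as ℕ
  open import Data.Integer as ℤ using (ℤ; +_; 0ℤ; _+_; _*_; _-_; -_; _≤_)
  import Data.Integer.Properties as ℤ
  open import Data.Integer.Tactic.RingSolver using (solve-∀)
  open import Data.Rational as ℚ using (_/_) renaming (_≤_ to _≤ℚ_)
  open import Data.Bool using (T)
  open import Data.Bool.Properties using (T-∧)
  open import Data.List using (length)
  open import Data.Vec using (Vec; toList)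
  open import Data.Vec.Relation.Unary.All using (All)
  open import Data.Product using (_×_; _,_; proj₁; proj₂)
  open import Data.Sum using (_⊎_; inj₁; inj₂)
  open import Function.Bundles using (Equivalence)
  open import Relation.Nullary using (Dec; yes; no; ¬_)
  open import Relation.Binary.PropositionalEquality using (_≡_; sym; trans; cong; cong₂; subst; module ≡-Reasoning)
  open FiniteSums
  open Lattice
  open IntegerBounds
  open CoordinateSums
  open SquaredDistances
  open Fractions

  k d N kk K t : ℕ
  k  = suc k-1
  d  = suc d-1
  N  = suc N-1
  kk = k ℕ.* k
  K  = length (cells N)
  t  = K ℕ.* (d ℕ.* N ℕ.* N)

  D : ℤ
  D = + d * + N * + N

  +dNN≡D : + (d ℕ.* N ℕ.* N) ≡ D
  +dNN≡D = trans (ℤ.pos-* (d ℕ.* N) N) (cong (_* + N) (ℤ.pos-* d N))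

  +t≡KD : + t ≡ + K * D
  +t≡KD = trans (ℤ.pos-* K (d ℕ.* N ℕ.* N)) (cong (+ K *_) +dNN≡D)

  deviation : Stat → Vec ℕ d → Vec ℕ d × Vec ℕ d → ℤ
  deviation φ a p = + 2 * + kk * coordSum (centre N φ) a p

  -- The statistic lies within d N² / (2k²) of its mean.
  Small : Stat → Vec ℕ d → Vec ℕ d × Vec ℕ d → Set
  Small φ a p = deviation φ a p * deviation φ a p ≤ + t * + t

  small⇒bounds : ∀ φ a p Φ (M : ℤ) r → coordSum φ a p ≡ + Φ →
    + 12 * ∑ (cellSum φ N) (toList a) ≡ + K * (M + + r * (+ d * + N)) → r ℕ.≤ 4 → 2 ℕ.* kk ℕ.≤ N → Small φ a p →
    + kk * (+ 12 * + Φ - M) ≤ + 12 * D × + kk * - (+ 12 * + Φ - M) ≤ + 12 * D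
  small⇒bounds φ a p Φ M r Φ≡ mean r≤4 2kk≤N small =
    deviation-bounds K kk d N r
      (trans (cong (λ x → + K * (+ 12 * x - M)) (sym Φ≡)) (centre-identity N φ a p M r mean))
      (subst (λ s → - s ≤ deviation φ a p) +t≡KD (proj₁ bounds))
      (subst (deviation φ a p ≤_) +t≡KD (proj₂ bounds)) r≤4 2kk≤N
    where
    bounds = square-≤⁻¹ (deviation φ a p) t small

  +4dNN≡4D : + (4 ℕ.* d ℕ.* N ℕ.* N) ≡ + 4 * D
  +4dNN≡4D = begin
    + (4 ℕ.* d ℕ.* N ℕ.* N)          ≡⟨ ℤ.pos-* (4 ℕ.* d ℕ.* N) N ⟩
    + (4 ℕ.* d ℕ.* N) * + N          ≡⟨ cong (_* + N) (trans (ℤ.pos-* (4 ℕ.* d) N) (cong (_* + N) (ℤ.pos-* 4 d))) ⟩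
    + 4 * + d * + N * + N            ≡⟨ reassoc (+ d) (+ N) ⟩
    + 4 * D                          ∎
    where
    open ≡-Reasoning
    reassoc : ∀ d N → + 4 * d * N * N ≡ + 4 * (d * N * N)
    reassoc = solve-∀

  -- sixth normalises to + 2 / 12, the form produced by close-by-scaling.
  distSq-w₁w₂-close : ∀ a w₁ w₂ → 2 ℕ.* kk ℕ.≤ N → Small d²-w₁w₂ a (w₁ , w₂) →
    distSq d N w₁ w₂ ≈[ + 1 / kk ] sixth
  distSq-w₁w₂-close a w₁ w₂ 2kk≤N small =
    close-by-scaling (+ Φ) (+ 2) (d ℕ.* N ℕ.* N) 12 kk (+ 1) E (+ 12 * D) (ℤ.+≤+ ℕ.z≤n) cross mn
      (proj₁ bounds) (proj₂ bounds)
    where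
    Φ = sqDist w₁ w₂
    E = + 12 * + Φ - + 2 * D
    bounds : + kk * E ≤ + 12 * D × + kk * - E ≤ + 12 * D
    bounds = small⇒bounds d²-w₁w₂ a (w₁ , w₂) Φ (+ 2 * D) 4 (coordSum-d²-w₁w₂ a w₁ w₂) (mean-d²-w₁w₂ N a)
                          ℕ.≤-refl 2kk≤N small
    cross : + Φ * + 12 - + 2 * + (d ℕ.* N ℕ.* N) ≡ + 1 * E
    cross = trans (cong (λ x → + Φ * + 12 - + 2 * x) +dNN≡D) (regroup (+ Φ) D)
      where
      regroup : ∀ Φ D → Φ * + 12 - + 2 * D ≡ + 1 * (+ 12 * Φ - + 2 * D)
      regroup = solve-∀
    mn : + (d ℕ.* N ℕ.* N) * + 12 ≡ + 1 * (+ 12 * D)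
    mn = trans (cong (_* + 12) +dNN≡D) (regroup D)
      where
      regroup : ∀ D → D * + 12 ≡ + 1 * (+ 12 * D)
      regroup = solve-∀

  distSq-a-close : ∀ φ → (∀ c → + 12 * cellSum φ N c
                                ≡ + suc N * + suc N * (+ 3 * ((+ 2 * + c - + N) * (+ 2 * + c - + N)) + + suc N * + suc N - + 1)) →
    ∀ a p w → coordSum φ a p ≡ + sqDist a w → 2 ℕ.* kk ℕ.≤ N → Small φ a p →
    distSq d N a w ≈[ + 1 / kk ] twelfth ℚ.+ rSq d N a
  distSq-a-close φ cellSum-φ a p w coordSum≡ 2kk≤N small =
    subst (distSq d N a w ≈[ + 1 / kk ]_)
          (sym (/-+-/ (+ 1) (+ s) 12 (4 ℕ.* d ℕ.* N ℕ.* N)))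
          (close-by-scaling (+ Φ) j (d ℕ.* N ℕ.* N) (12 ℕ.* (4 ℕ.* d ℕ.* N ℕ.* N)) kk (+ 4 * D) E (+ 12 * D)
             (ℤ.+≤+ ℕ.z≤n) cross mn (proj₁ bounds) (proj₂ bounds))
    where
    Φ = sqDist a w
    s = sqDev N a
    j = + 1 * + (4 ℕ.* d ℕ.* N ℕ.* N) + + s * + 12
    E = + 12 * + Φ - (D + + 3 * + s)
    bounds : + kk * E ≤ + 12 * D × + kk * - E ≤ + 12 * D
    bounds = small⇒bounds φ a p Φ (D + + 3 * + s) 2 coordSum≡ (mean-d²-a N φ cellSum-φ a) (ℕ.m≤m+n 2 2) 2kk≤N small
    +12*4dNN≡ : + (12 ℕ.* (4 ℕ.* d ℕ.* N ℕ.* N)) ≡ + 12 * (+ 4 * D)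
    +12*4dNN≡ = trans (ℤ.pos-* 12 (4 ℕ.* d ℕ.* N ℕ.* N)) (cong (+ 12 *_) +4dNN≡4D)
    cross : + Φ * + (12 ℕ.* (4 ℕ.* d ℕ.* N ℕ.* N)) - j * + (d ℕ.* N ℕ.* N) ≡ + 4 * D * E
    cross = begin
      + Φ * + (12 ℕ.* (4 ℕ.* d ℕ.* N ℕ.* N)) - j * + (d ℕ.* N ℕ.* N)
        ≡⟨ cong₂ (λ x y → + Φ * x - (+ 1 * y + + s * + 12) * + (d ℕ.* N ℕ.* N)) +12*4dNN≡ +4dNN≡4D ⟩
      + Φ * (+ 12 * (+ 4 * D)) - (+ 1 * (+ 4 * D) + + s * + 12) * + (d ℕ.* N ℕ.* N)
        ≡⟨ cong (λ x → + Φ * (+ 12 * (+ 4 * D)) - (+ 1 * (+ 4 * D) + + s * + 12) * x) +dNN≡D ⟩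
      + Φ * (+ 12 * (+ 4 * D)) - (+ 1 * (+ 4 * D) + + s * + 12) * D
        ≡⟨ factor (+ Φ) D (+ s) ⟩
      + 4 * D * E ∎
      where
      open ≡-Reasoning
      factor : ∀ Φ D s → Φ * (+ 12 * (+ 4 * D)) - (+ 1 * (+ 4 * D) + s * + 12) * D ≡ + 4 * D * (+ 12 * Φ - (D + + 3 * s))
      factor = solve-∀
    mn : + (d ℕ.* N ℕ.* N) * + (12 ℕ.* (4 ℕ.* d ℕ.* N ℕ.* N)) ≡ + 4 * D * (+ 12 * D)
    mn = trans (cong₂ _*_ +dNN≡D +12*4dNN≡) (regroup D)
      where
      regroup : ∀ D → D * (+ 12 * (+ 4 * D)) ≡ + 4 * D * (+ 12 * D)
      regroup = solve-∀

  good-if-small : ∀ ε a w₁ w₂ → 2 ℕ.* kk ℕ.≤ N → + 1 / kk ≤ℚ ε ℚ.* ε → let p = w₁ , w₂ in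
    Small d²-w₁w₂ a p → Small d²-aw₁ a p → Small d²-aw₂ a p → T (good d N ε a p)
  good-if-small ε a w₁ w₂ 2kk≤N q≤εε small₁₂ small₀₁ small₀₂ =
    Equivalence.from T-∧ (close₁₂ , Equivalence.from T-∧ (close₀₁ , close₀₂))
    where
    p = w₁ , w₂
    close₁₂ = sqrtClose-of-≈ ε (distSq-w₁w₂-close a w₁ w₂ 2kk≤N small₁₂) q≤εε
    close₀₁ = sqrtClose-of-≈ ε (distSq-a-close d²-aw₁ (cellSum-d²-aw₁ N) a p w₁ (coordSum-d²-aw₁ a w₁ w₂)
                                               2kk≤N small₀₁) q≤εε
    close₀₂ = sqrtClose-of-≈ ε (distSq-a-close d²-aw₂ (cellSum-d²-aw₂ N) a p w₂ (coordSum-d²-aw₂ a w₁ w₂)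
                                               2kk≤N small₀₂) q≤εε

  excess : Vec ℕ d → Vec ℕ d × Vec ℕ d → ℤ
  excess a p = deviation d²-w₁w₂ a p * deviation d²-w₁w₂ a p
             + deviation d²-aw₁ a p * deviation d²-aw₁ a p
             + deviation d²-aw₂ a p * deviation d²-aw₂ a p

  ≤-excess : ∀ a p → let sq φ = deviation φ a p * deviation φ a p in
    sq d²-w₁w₂ ≤ excess a p × sq d²-aw₁ ≤ excess a p × sq d²-aw₂ ≤ excess a p
  ≤-excess a p = ≤-+₃ (0≤x*x (dev d²-w₁w₂)) (0≤x*x (dev d²-aw₁)) (0≤x*x (dev d²-aw₂))
    where
    dev : Stat → ℤ
    dev φ = deviation φ a p

  excess-nonNeg : ∀ a p → 0ℤ ≤ excess a p
  excess-nonNeg a p = ℤ.≤-trans (0≤x*x (deviation d²-w₁w₂ a p)) (proj₁ (≤-excess a p))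

  small? : ∀ φ a p → Dec (Small φ a p)
  small? φ a p = deviation φ a p * deviation φ a p ℤ.≤? + t * + t

  ¬small⇒large : ∀ φ a p → ¬ Small φ a p → + t * + t ≤ deviation φ a p * deviation φ a p
  ¬small⇒large φ a p ¬small = ℤ.<⇒≤ (ℤ.≰⇒> ¬small)

  good-or-large : ∀ ε a → 2 ℕ.* kk ℕ.≤ N → + 1 / kk ≤ℚ ε ℚ.* ε →
    ∀ p → T (good d N ε a p) ⊎ + t * + t ≤ excess a p
  good-or-large ε a 2kk≤N q≤εε p@(w₁ , w₂) = decide (small? d²-w₁w₂ a p) (small? d²-aw₁ a p) (small? d²-aw₂ a p)
    where
    ≤excess₁₂ = proj₁ (≤-excess a p)
    ≤excess₀₁ = proj₁ (proj₂ (≤-excess a p))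
    ≤excess₀₂ = proj₂ (proj₂ (≤-excess a p))
    decide : Dec (Small d²-w₁w₂ a p) → Dec (Small d²-aw₁ a p) → Dec (Small d²-aw₂ a p) →
             T (good d N ε a p) ⊎ + t * + t ≤ excess a p
    decide (yes s₁₂) (yes s₀₁) (yes s₀₂) = inj₁ (good-if-small ε a w₁ w₂ 2kk≤N q≤εε s₁₂ s₀₁ s₀₂)
    decide (no ¬s₁₂) _         _         = inj₂ (ℤ.≤-trans (¬small⇒large d²-w₁w₂ a p ¬s₁₂) ≤excess₁₂)
    decide (yes _)   (no ¬s₀₁) _         = inj₂ (ℤ.≤-trans (¬small⇒large d²-aw₁ a p ¬s₀₁) ≤excess₀₁)
    decide (yes _)   (yes _)   (no ¬s₀₂) = inj₂ (ℤ.≤-trans (¬small⇒large d²-aw₂ a p ¬s₀₂) ≤excess₀₂)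

  KM : ℕ
  KM = K ℕ.* (N ℕ.* N)

  V : ℤ
  V = + d * (+ totalCount d N * (+ KM * + KM))

  ∑-deviation-square-≤ : ∀ φ → BoundedOn N (N ℕ.* N) φ → ∀ a → All (ℕ._≤ N) a →
    ∑[ p ∈ pairs d N ] (deviation φ a p * deviation φ a p) ≤ + 2 * + kk * (+ 2 * + kk) * V
  ∑-deviation-square-≤ φ bounded a a≤N = begin
    ∑[ p ∈ pairs d N ] (deviation φ a p * deviation φ a p)
      ≡⟨ ∑-cong (λ p → regroup (+ 2 * + kk) (Z p)) (pairs d N) ⟩
    ∑[ p ∈ pairs d N ] (c * (Z p * Z p))
      ≡⟨ ∑-*ˡ c (λ p → Z p * Z p) (pairs d N) ⟩
    c * ∑[ p ∈ pairs d N ] (Z p * Z p)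
      ≤⟨ ℤ.*-monoˡ-≤-nonNeg c (∑-centred-square-≤ N φ (N ℕ.* N) bounded a a≤N) ⟩
    c * V ∎
    where
    open ℤ.≤-Reasoning
    c = + 2 * + kk * (+ 2 * + kk)
    Z = coordSum (centre N φ) a
    regroup : ∀ c z → c * z * (c * z) ≡ c * c * (z * z)
    regroup = solve-∀

  ∑-excess-≤ : ∀ a → All (ℕ._≤ N) a → ∑ (excess a) (pairs d N) ≤ + 12 * + kk * + kk * V
  ∑-excess-≤ a a≤N = begin
    ∑ (excess a) (pairs d N)
      ≡⟨ trans (∑-+ (λ p → sq d²-w₁w₂ p + sq d²-aw₁ p) (sq d²-aw₂) (pairs d N))
               (cong (_+ ∑ (sq d²-aw₂) (pairs d N)) (∑-+ (sq d²-w₁w₂) (sq d²-aw₁) (pairs d N))) ⟩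
    ∑ (sq d²-w₁w₂) (pairs d N) + ∑ (sq d²-aw₁) (pairs d N) + ∑ (sq d²-aw₂) (pairs d N)
      ≤⟨ ℤ.+-mono-≤ (ℤ.+-mono-≤ (∑-deviation-square-≤ d²-w₁w₂ (bounded-d²-w₁w₂ N) a a≤N)
                                (∑-deviation-square-≤ d²-aw₁ (bounded-d²-aw₁ N) a a≤N))
                    (∑-deviation-square-≤ d²-aw₂ (bounded-d²-aw₂ N) a a≤N) ⟩
    W + W + W
      ≡⟨ triple (+ kk) V ⟩
    + 12 * + kk * + kk * V ∎
    where
    open ℤ.≤-Reasoning
    sq : Stat → Vec ℕ d × Vec ℕ d → ℤ
    sq φ p = deviation φ a p * deviation φ a p
    W = + 2 * + kk * (+ 2 * + kk) * V
    triple : ∀ kk V → let W = + 2 * kk * (+ 2 * kk) * V in W + W + W ≡ + 12 * kk * kk * V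
    triple = solve-∀

  excess-budget : ∀ a → All (ℕ._≤ N) a → 12 ℕ.* k ℕ.* kk ℕ.* kk ℕ.≤ d →
    + k * ∑ (excess a) (pairs d N) ≤ + totalCount d N * (+ t * + t)
  excess-budget a a≤N 12k⁵≤d = begin
    + k * ∑ (excess a) (pairs d N)         ≤⟨ ℤ.*-monoˡ-≤-nonNeg (+ k) (∑-excess-≤ a a≤N) ⟩
    + k * (+ 12 * + kk * + kk * V)         ≡⟨ regroup (+ k) (+ kk) V ⟩
    + 12 * + k * + kk * + kk * V           ≤⟨ ℤ.*-monoʳ-≤-nonNeg V {{ℤ.nonNegative V≥0}} 12k⁵≤d′ ⟩
    + d * V                                ≡⟨ cong₂ (λ x y → + d * (+ d * (+ total * (x * y)))) +KM≡ +KM≡ ⟩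
    + d * (+ d * (+ total * (+ K * (+ N * + N) * (+ K * (+ N * + N)))))
                                           ≡⟨ collect (+ d) (+ total) (+ K) (+ N) ⟩
    + total * (+ K * D * (+ K * D))        ≡⟨ cong (λ x → + total * (x * x)) +t≡KD ⟨
    + totalCount d N * (+ t * + t)                ∎
    where
    open ℤ.≤-Reasoning
    total = totalCount d N
    regroup : ∀ k kk V → k * (+ 12 * kk * kk * V) ≡ + 12 * k * kk * kk * V
    regroup = solve-∀
    collect : ∀ d T K N → d * (d * (T * (K * (N * N) * (K * (N * N))))) ≡ T * (K * (d * N * N) * (K * (d * N * N)))
    collect = solve-∀
    +KM≡ : + KM ≡ + K * (+ N * + N)
    +KM≡ = trans (ℤ.pos-* K (N ℕ.* N)) (cong (+ K *_) (ℤ.pos-* N N))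
    12k⁵≤d′ : + 12 * + k * + kk * + kk ≤ + d
    12k⁵≤d′ = subst (_≤ + d) (trans (ℤ.pos-* (12 ℕ.* k ℕ.* kk) kk)
                                (cong (_* + kk) (trans (ℤ.pos-* (12 ℕ.* k) kk) (cong (_* + kk) (ℤ.pos-* 12 k)))))
                    (ℤ.+≤+ 12k⁵≤d)
    V≥0 : 0ℤ ≤ V
    V≥0 = subst (0ℤ ≤_) (trans (ℤ.pos-* d (total ℕ.* (KM ℕ.* KM)))
                           (cong (+ d *_) (trans (ℤ.pos-* total (KM ℕ.* KM)) (cong (+ total *_) (ℤ.pos-* KM KM)))))
                (ℤ.+≤+ ℕ.z≤n)

  most-pairs-good : ∀ ε a → All (ℕ._≤ N) a → 12 ℕ.* k ℕ.* kk ℕ.* kk ℕ.≤ d → 2 ℕ.* kk ℕ.≤ N →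
    + 1 / kk ≤ℚ ε ℚ.* ε →
    + k * + totalCount d N ≤ + k * + goodCount d N ε a + + totalCount d N
  most-pairs-good ε a a≤N 12k⁵≤d 2kk≤N q≤εε =
    count-from-markov k (totalCount d N) (goodCount d N ε a) (+ t * + t) (∑ (excess a) (pairs d N))
      (markov (good d N ε a) (excess a) (+ t * + t) (excess-nonNeg a) (good-or-large ε a 2kk≤N q≤εε) (pairs d N))
      (excess-budget a a≤N 12k⁵≤d)

open Fractions using (∃1/[1+k]≤; 1/k≤ε⇒1/k²≤ε²; kT≤kG+T⇒[1-ε]T≤G)
open import Data.Nat as ℕ using (zero; suc; _≤_)
open import Data.Rational using (ℚ; 0ℚ; 1ℚ; _-_; _*_; _<_) renaming (_≤_ to _≤ℚ_)
open import Data.Vec using (Vec)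
open import Data.Vec.Relation.Unary.All using (All)
open import Data.Product using (Σ; _×_; _,_; proj₁; proj₂)

theorem1p3 : (ε : ℚ) → 0ℚ < ε →
    Σ ℕ (λ dε → Σ ℕ (λ Nε → (1 ≤ dε) × (1 ≤ Nε) ×
      ((d N : ℕ) → dε ≤ d → Nε ≤ N → (a : Vec ℕ d) → All (λ x → x ≤ N) a →
        ((1ℚ - ε) * toℚ (totalCount d N)) ≤ℚ toℚ (goodCount d N ε a))))
-- d ≥ 12k⁵ keeps the Chebyshev bounds below T/k; N ≥ 2k² absorbs the bias of the means.
theorem1p3 ε 0<ε = 12 ℕ.* k ℕ.* kk ℕ.* kk , 2 ℕ.* kk , ℕ.s≤s ℕ.z≤n , ℕ.s≤s ℕ.z≤n , bound
  where
  k-1 = proj₁ (∃1/[1+k]≤ ε 0<ε)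
  1/k≤ε = proj₂ (∃1/[1+k]≤ ε 0<ε)
  k = suc k-1
  kk = k ℕ.* k
  bound : (d N : ℕ) → 12 ℕ.* k ℕ.* kk ℕ.* kk ≤ d → 2 ℕ.* kk ≤ N → (a : Vec ℕ d) → All (λ x → x ≤ N) a →
          ((1ℚ - ε) * toℚ (totalCount d N)) ≤ℚ toℚ (goodCount d N ε a)
  bound zero      _         ()     _     _ _
  bound (suc _)   zero      _      ()    _ _
  bound d@(suc d-1) N@(suc N-1) 12k⁵≤d 2kk≤N a a≤N =
    kT≤kG+T⇒[1-ε]T≤G k (totalCount d N) (goodCount d N ε a) ε 1/k≤ε
      (Estimate.most-pairs-good k-1 d-1 N-1 ε a a≤N 12k⁵≤d 2kk≤N (1/k≤ε⇒1/k²≤ε² k ε 1/k≤ε))
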